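{- Let $F$ be a $2$-connected graph with $r$ vertices, let $H_F$ be an $F$-graph, and let $F_0$ be a copy of $F$, not present as an $F$-edge of $H_F$, such that $F_0\subseteq G(H_F)$. Then either (i) $\hat H_F$ contains an avoidable configuration, or (ii) $\hat H_F$ contains a clean $k$-cycle $H$ for some $2\le k\le e(F)$, such that every edge of $F_0$ is contained in some hyperedge of $H$. Furthermore, if $F$ is nice, then (i) holds.
   Context: An $F$-graph $H_F=(V,E)$ consists of a finite vertex set $V$ and a set $E$ of distinct subgraphs isomorphic to $F$ (called $F$-edges) with vertices in $V$. $\hat H_F$ is the underlying $r$-uniform multi-hypergraph obtained by replacing each $F$-edge by a hyperedge equal to its vertex set (hyperedges with equal vertex sets are kept as distinct hyperedges). $G(H_F)$ is the simple graph that is the union of all $F$-edges of $H_F$. For an $r$-uniform (multi-)hypergraph $C$ with $|C|$ vertices, $e(C)$ hyperedges and $c(C)$ components, its nullity is $n(C)=(r-1)e(C)+c(C)-|C|$; a connected one is complex if its nullity is at least $2$ (so two hyperedges with the same vertex set form a complex hypergraph when $r\ge3$). An avoidable configuration is a connected, complex $r$-uniform (multi-)hypergraph with at most $2\binom r2$ hyperedges. An $r$-uniform hypergraph is a clean $k$-cycle ($k\ge2$) if it is obtained from a graph $k$-cycle by adding $r-2$ new vertices to each edge, all added vertices being distinct (for $k=2$: two hyperedges sharing exactly $2$ vertices). $F$ is nice if (i) $F$ is strictly $1$-balanced, i.e. $e(F')/(|F'|-1)<e(F)/(|F|-1)$ for every proper subgraph $F'$ with at least two vertices, (ii) $F$ is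 $3$-connected, and (iii) $F$ cannot be transformed into a graph isomorphic to $F$ by adding one edge and deleting one edge. -}

module Defs where

open import Data.Bool using (Bool; true; false; _∧_; _∨_; not; T)
open import Data.Nat using (ℕ; zero; suc; _+_; _*_; _∸_; _≤_; _<_; _<ᵇ_)
open import Data.Nat.Combinatorics using (_C_)
open import Data.Fin using (Fin; toℕ; _≟_)
open import Data.Fin.Subset using (Subset; _∈_; _∉_; ∣_∣)
open import Data.Fin.Subset.Properties using (_∈?_)
open import Data.Fin.Properties using (any?)
open import Data.Product using (Σ; ∃; _×_; _,_; proj₁)
open import Data.Sum using (_⊎_)
open import Data.Vec using (tabulate)
open import Function.Definitions using (Injective)
open import Function.Bundles using (_⇔_)
open import Relation.Nullary using (¬_; does)
open import Relation.Nullary.Decidable using (_×-dec_)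
open import Relation.Binary.PropositionalEquality using (_≡_; _≢_)

sumFin : ∀ {k} → (Fin k → ℕ) → ℕ
sumFin {zero}  f = 0
sumFin {suc k} f = f Fin.zero + sumFin (λ i → f (Fin.suc i))

count : ∀ {k} → (Fin k → Bool) → ℕ
count f = sumFin (λ i → b2n (f i))
  where
  b2n : Bool → ℕ
  b2n true  = 1
  b2n false = 0

record Graph (r : ℕ) : Set where
  field
    adj    : Fin r → Fin r → Bool
    sym    : ∀ u v → adj u v ≡ adj v u
    irrefl : ∀ u → adj u u ≡ false
open Graph public

numEdges : ∀ {r} → Graph r → ℕ
numEdges F = sumFin (λ a → count (λ b → (toℕ a <ᵇ toℕ b) ∧ adj F a b))

data Walk {r} (F : Graph r) (X : Subset r) (u : Fin r) : Fin r → Set where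
  here : Walk F X u u
  step : ∀ {v w} → Walk F X u v → adj F v w ≡ true → w ∉ X → Walk F X u w

KConnected : ℕ → ∀ {r} → Graph r → Set
KConnected k {r} F =
  (k < r) × (∀ (X : Subset r) → ∣ X ∣ < k →
             ∀ u v → u ∉ X → v ∉ X → Walk F X u v)

record SubGraph {r} (F : Graph r) : Set where
  field
    W     : Subset r
    E     : Fin r → Fin r → Bool
    Esym  : ∀ a b → E a b ≡ E b a
    E⊆F   : ∀ a b → E a b ≡ true → adj F a b ≡ true
    E⊆W   : ∀ a b → E a b ≡ true → a ∈ W
open SubGraph public

subEdges : ∀ {r} {F : Graph r} → SubGraph F → ℕ
subEdges F' = sumFin (λ a → count (λ b → (toℕ a <ᵇ toℕ b) ∧ E F' a b))

Proper : ∀ {r} {F : Graph r} → SubGraph F → Set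
Proper {r} {F} F' =
  (Σ (Fin r) λ a → a ∉ W F') ⊎
  (Σ (Fin r) λ a → Σ (Fin r) λ b → adj F a b ≡ true × E F' a b ≡ false)

-- e(F')/(|F'|-1) < e(F)/(|F|-1), with positive denominators, cross-multiplied
Strictly1Balanced : ∀ {r} → Graph r → Set
Strictly1Balanced {r} F =
  ∀ (F' : SubGraph F) → Proper F' → 2 ≤ ∣ W F' ∣ →
    subEdges F' * (r ∸ 1) < numEdges F * (∣ W F' ∣ ∸ 1)

isPair : ∀ {r} → Fin r → Fin r → Fin r → Fin r → Bool
isPair a b u v = (does (a ≟ u) ∧ does (b ≟ v)) ∨ (does (a ≟ v) ∧ does (b ≟ u))

swapAdj : ∀ {r} → Graph r → (a b c d : Fin r) → Fin r → Fin r → Bool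
swapAdj F a b c d u v = (adj F u v ∧ not (isPair c d u v)) ∨ isPair a b u v

-- F + ab − cd is isomorphic to F (σ injective on Fin r, hence a bijection)
SwapIso : ∀ {r} → Graph r → (a b c d : Fin r) → Set
SwapIso {r} F a b c d =
  Σ (Fin r → Fin r) λ σ → Injective _≡_ _≡_ σ ×
    (∀ u v → swapAdj F a b c d (σ u) (σ v) ≡ adj F u v)

NoSwap : ∀ {r} → Graph r → Set
NoSwap {r} F = ∀ (a b c d : Fin r) → a ≢ b → adj F a b ≡ false →
  adj F c d ≡ true → ¬ SwapIso F a b c d

Nice : ∀ {r} → Graph r → Set
Nice F = Strictly1Balanced F × KConnected 3 F × NoSwap F

-- a copy of F: an injective map Fin r → Fin n; the copy is the image subgraph
record Copy {r} (F : Graph r) (n : ℕ) : Set where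
  constructor copy
  field
    emb    : Fin r → Fin n
    embInj : Injective _≡_ _≡_ emb
open Copy public

InCopy : ∀ {r n} {F : Graph r} → Copy F n → Fin n → Set
InCopy {r} (copy φ _) v = Σ (Fin r) λ a → φ a ≡ v

EdgeOfCopy : ∀ {r n} {F : Graph r} → Copy F n → Fin n → Fin n → Set
EdgeOfCopy {r} {F = F} (copy φ _) u v =
  Σ (Fin r) λ a → Σ (Fin r) λ b → φ a ≡ u × φ b ≡ v × adj F a b ≡ true

SameCopy : ∀ {r n} {F : Graph r} → Copy F n → Copy F n → Set
SameCopy φ ψ = (∀ v → InCopy φ v ⇔ InCopy ψ v) ×
               (∀ u v → EdgeOfCopy φ u v ⇔ EdgeOfCopy ψ u v)

record FGraph {r} (F : Graph r) (n m : ℕ) : Set where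
  field
    fedge    : Fin m → Copy F n
    distinct : ∀ i j → i ≢ j → ¬ SameCopy (fedge i) (fedge j)
open FGraph public

module _ {r n m} {F : Graph r} (H : FGraph F n m) where

  InHE : Fin m → Fin n → Set
  InHE i v = InCopy (fedge H i) v

  EdgeOfG : Fin n → Fin n → Set
  EdgeOfG u v = Σ (Fin m) λ i → EdgeOfCopy (fedge H i) u v

  VertexOfG : Fin n → Set
  VertexOfG v = Σ (Fin m) λ i → InHE i v

  CopyInG : Copy F n → Set
  CopyInG ψ = (∀ v → InCopy ψ v → VertexOfG v) ×
              (∀ u v → EdgeOfCopy ψ u v → EdgeOfG u v)

  -- sub-hypergraph of Ĥ_F spanned by a set S of hyperedges:
  -- its vertex set is the union of those hyperedges
  subVerts : Subset m → Subset n
  subVerts S = tabulate λ v →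
    does (any? (λ i → (i ∈? S) ×-dec any? (λ a → emb (fedge H i) a ≟ v)))

  data HWalk (S : Subset m) (u : Fin n) : Fin n → Set where
    here : HWalk S u u
    step : ∀ {v w} (i : Fin m) → i ∈ S → InHE i v → InHE i w →
           HWalk S u v → HWalk S u w

  HConnected : Subset m → Set
  HConnected S = ∀ u v → u ∈ subVerts S → v ∈ subVerts S → HWalk S u v

  -- connected and complex: nullity (r-1)e(C) + c(C) − |C| ≥ 2 with c(C) = 1
  ConnectedComplex : Subset m → Set
  ConnectedComplex S =
    HConnected S × (2 + ∣ subVerts S ∣ ≤ (r ∸ 1) * ∣ S ∣ + 1)

  HasAvoidable : Set
  HasAvoidable = Σ (Subset m) λ S →
    ConnectedComplex S × ∣ S ∣ ≤ 2 * (r C 2)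

  CycSucc : ∀ {k} → Fin k → Fin k → Set
  CycSucc {k} i j = (toℕ j ≡ suc (toℕ i)) ⊎ (suc (toℕ i) ≡ k × toℕ j ≡ 0)

  CleanCycleCovering : ℕ → Copy F n → Set
  CleanCycleCovering k ψ =
    Σ (Fin k → Fin m) λ h → Σ (Fin k → Fin n) λ x →
      Injective _≡_ _≡_ h × Injective _≡_ _≡_ x ×
      (∀ i j → InHE (h j) (x i) ⇔ (i ≡ j ⊎ CycSucc j i)) ×
      (∀ j l v → j ≢ l → InHE (h j) v → InHE (h l) v →
         Σ (Fin k) λ i → x i ≡ v) ×
      (∀ u v → EdgeOfCopy ψ u v →
         Σ (Fin k) λ j → InHE (h j) u × InHE (h j) v)

-- Take a hyperedge e₀ containing an edge of F₀.  If F₀ lies inside e₀, then, F₀ being a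
-- different copy with the same number of edges, some edge ab of F₀ is not an edge of the copy e₀,
-- and the hyperedge carrying ab forms a 2-cycle with e₀.  Otherwise an edge uw of F₀ leaves e₀;
-- F₀ − u is connected, and the hyperedges carrying the edges of a path from w back to e₀ give a
-- cycle of hyperedges through vertices of F₀.  A cycle of k hyperedges has nullity at least one,
-- and at least two unless it is clean.  A clean cycle is then enlarged along edges of F₀ leaving
-- it: a new hyperedge meeting the current set twice gives nullity two, and one meeting it in a
-- single vertex c would disconnect F₀ − c.  So either an avoidable configuration appears or the
-- clean cycle covers F₀; its k vertices are vertices of F₀, and e(F) ≥ |F| as F has minimum
-- degree two.
--
-- If F is 3-connected, a hyperedge of the clean covering cycle contains all of F₀: a
-- vertex of F₀ off the cycle cannot leave its hyperedge in F₀ minus two cycle vertices, and if all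
-- vertices were cycle vertices, removing the two cycle neighbours of one of them would isolate it.
-- Comparing F₀ with that copy, two different missing edges give an avoidable configuration on at
-- most three hyperedges, while a single missing edge ab together with the single surplus edge cd
-- would make F + ab − cd isomorphic to F.

module Submission where

open import Defs renaming (sym to adj-sym)
open import Data.Bool using (Bool; true; false; _∧_; _∨_; not; T) renaming (_≟_ to _≟ᵇ_)
open import Data.Bool.Properties using (∧-comm; ∧-zeroʳ; ∧-identityʳ; ∨-identityʳ; ∨-zeroʳ)
open import Data.Empty using (⊥; ⊥-elim)
open import Data.Fin using (Fin; toℕ; _≟_; fromℕ<; fromℕ; inject₁; punchOut)
  renaming (zero to fz; suc to fs)
open import Data.Fin.Permutation using (Permutation; permutation)
open import Data.Fin.Properties
  using (any?; suc-injective; toℕ-injective; toℕ<n; fromℕ<-toℕ; toℕ-fromℕ<; toℕ-fromℕ;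
         toℕ-inject₁; injective⇒≤; punchOut-injective)
open import Data.Fin.Subset
  using (Subset; _∈_; _∉_; ∣_∣; _∪_; _∩_; _─_; ⁅_⁆; _⊆_; ⊤; ∁)
  renaming (⊥ to ∅)
open import Data.Fin.Subset.Properties
open import Data.Nat using (ℕ; zero; suc; _+_; _*_; _∸_; _≤_; _<_; z≤n; s≤s; _≤?_; _<?_; _<ᵇ_)
open import Data.Nat.Combinatorics using (_C_; nC1≡n; nCk+nC[k+1]≡[n+1]C[k+1])
open import Data.Nat.Properties hiding (_≟_; suc-injective)
import Data.Nat.Properties as ℕ
open import Data.Product using (Σ; ∃; _×_; _,_; proj₁; proj₂)
open import Data.Sum using (_⊎_; inj₁; inj₂; [_,_]′)
import Data.Sum as Sum
open import Data.Vec using (tabulate; []; _∷_)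
open import Data.Vec.Properties using (lookup⇒[]=; []=⇒lookup; lookup∘tabulate)
open import Function.Base using (_∘_; id)
open import Function.Bundles using (_⇔_; mk⇔)
open import Function.Definitions using (Injective)
open import Relation.Binary.PropositionalEquality
open import Relation.Nullary using (¬_; Dec; yes; no; does)
open import Relation.Nullary.Decidable using (_×-dec_; _⊎-dec_; ¬?; dec-true; decidable-stable)
import Algebra.Properties.CommutativeMonoid.Sum as CommutativeMonoidSum
open import Data.Nat.Solver using (module +-*-Solver)
open +-*-Solver using (solve; _:+_; _:*_; _:=_; con)

-- Cardinalities of finite subsets

∣p∪q∣+∣p∩q∣≡∣p∣+∣q∣ : ∀ {n} (p q : Subset n) → ∣ p ∪ q ∣ + ∣ p ∩ q ∣ ≡ ∣ p ∣ + ∣ q ∣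
∣p∪q∣+∣p∩q∣≡∣p∣+∣q∣ [] [] = refl
∣p∪q∣+∣p∩q∣≡∣p∣+∣q∣ (true ∷ p) (true ∷ q) = cong suc (begin
  ∣ p ∪ q ∣ + suc ∣ p ∩ q ∣ ≡⟨ +-suc ∣ p ∪ q ∣ ∣ p ∩ q ∣ ⟩
  suc (∣ p ∪ q ∣ + ∣ p ∩ q ∣) ≡⟨ cong suc (∣p∪q∣+∣p∩q∣≡∣p∣+∣q∣ p q) ⟩
  suc (∣ p ∣ + ∣ q ∣) ≡⟨ +-suc ∣ p ∣ ∣ q ∣ ⟨
  ∣ p ∣ + suc ∣ q ∣ ∎)
  where open ≡-Reasoning
∣p∪q∣+∣p∩q∣≡∣p∣+∣q∣ (true ∷ p) (false ∷ q) = cong suc (∣p∪q∣+∣p∩q∣≡∣p∣+∣q∣ p q)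
∣p∪q∣+∣p∩q∣≡∣p∣+∣q∣ (false ∷ p) (true ∷ q) =
  trans (cong suc (∣p∪q∣+∣p∩q∣≡∣p∣+∣q∣ p q)) (sym (+-suc ∣ p ∣ ∣ q ∣))
∣p∪q∣+∣p∩q∣≡∣p∣+∣q∣ (false ∷ p) (false ∷ q) = ∣p∪q∣+∣p∩q∣≡∣p∣+∣q∣ p q

∣p─q∣+∣p∩q∣≡∣p∣ : ∀ {n} (p q : Subset n) → ∣ p ─ q ∣ + ∣ p ∩ q ∣ ≡ ∣ p ∣
∣p─q∣+∣p∩q∣≡∣p∣ [] [] = refl
∣p─q∣+∣p∩q∣≡∣p∣ (true ∷ p) (true ∷ q) =
  trans (+-suc ∣ p ─ q ∣ ∣ p ∩ q ∣) (cong suc (∣p─q∣+∣p∩q∣≡∣p∣ p q))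
∣p─q∣+∣p∩q∣≡∣p∣ (true ∷ p) (false ∷ q) = cong suc (∣p─q∣+∣p∩q∣≡∣p∣ p q)
∣p─q∣+∣p∩q∣≡∣p∣ (false ∷ p) (true ∷ q) = ∣p─q∣+∣p∩q∣≡∣p∣ p q
∣p─q∣+∣p∩q∣≡∣p∣ (false ∷ p) (false ∷ q) = ∣p─q∣+∣p∩q∣≡∣p∣ p q

∣p∪q∣≤∣p∣+∣q∣ : ∀ {n} (p q : Subset n) → ∣ p ∪ q ∣ ≤ ∣ p ∣ + ∣ q ∣
∣p∪q∣≤∣p∣+∣q∣ p q = subst (∣ p ∪ q ∣ ≤_) (∣p∪q∣+∣p∩q∣≡∣p∣+∣q∣ p q) (m≤m+n _ _)

x∈p⇒0<∣p∣ : ∀ {n} {x : Fin n} {p : Subset n} → x ∈ p → 0 < ∣ p ∣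
x∈p⇒0<∣p∣ {x = x} {p} x∈p =
  subst (_≤ ∣ p ∣) (∣⁅x⁆∣≡1 x) (p⊆q⇒∣p∣≤∣q∣ λ y∈ → subst (_∈ p) (sym (x∈⁅y⁆⇒x≡y _ y∈)) x∈p)

x∈p∩q⇒∣p∪q∣<∣p∣+∣q∣ : ∀ {n} {x : Fin n} (p q : Subset n) → x ∈ p → x ∈ q →
                      ∣ p ∪ q ∣ < ∣ p ∣ + ∣ q ∣
x∈p∩q⇒∣p∪q∣<∣p∣+∣q∣ p q x∈p x∈q = subst (suc ∣ p ∪ q ∣ ≤_) (∣p∪q∣+∣p∩q∣≡∣p∣+∣q∣ p q)
  (subst (_≤ ∣ p ∪ q ∣ + ∣ p ∩ q ∣) (+-comm ∣ p ∪ q ∣ 1)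
    (+-monoʳ-≤ ∣ p ∪ q ∣ (x∈p⇒0<∣p∣ (x∈p∩q⁺ (x∈p , x∈q)))))

Disjoint : ∀ {n} → Subset n → Subset n → Set
Disjoint p q = ∀ {x} → x ∈ p → x ∈ q → ⊥

disjoint⇒∣p∪q∣≡∣p∣+∣q∣ : ∀ {n} (p q : Subset n) → Disjoint p q → ∣ p ∪ q ∣ ≡ ∣ p ∣ + ∣ q ∣
disjoint⇒∣p∪q∣≡∣p∣+∣q∣ {n} p q disj = begin
  ∣ p ∪ q ∣               ≡⟨ +-identityʳ _ ⟨
  ∣ p ∪ q ∣ + 0           ≡⟨ cong (∣ p ∪ q ∣ +_) ∣p∩q∣≡0 ⟨
  ∣ p ∪ q ∣ + ∣ p ∩ q ∣   ≡⟨ ∣p∪q∣+∣p∩q∣≡∣p∣+∣q∣ p q ⟩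
  ∣ p ∣ + ∣ q ∣           ∎
  where
  open ≡-Reasoning
  ∣p∩q∣≡0 : ∣ p ∩ q ∣ ≡ 0
  ∣p∩q∣≡0 = trans (cong ∣_∣ (Empty-unique λ (y , y∈) → disj (proj₁ (x∈p∩q⁻ p q y∈)) (proj₂ (x∈p∩q⁻ p q y∈))))
                  (∣⊥∣≡0 n)

∣p∪⁅x⁆∣≡1+∣p∣ : ∀ {n} (p : Subset n) x → x ∉ p → ∣ p ∪ ⁅ x ⁆ ∣ ≡ suc ∣ p ∣
∣p∪⁅x⁆∣≡1+∣p∣ p x x∉p = begin
  ∣ p ∪ ⁅ x ⁆ ∣       ≡⟨ disjoint⇒∣p∪q∣≡∣p∣+∣q∣ p ⁅ x ⁆ (λ y∈p y∈x → x∉p (subst (_∈ p) (x∈⁅y⁆⇒x≡y _ y∈x) y∈p)) ⟩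
  ∣ p ∣ + ∣ ⁅ x ⁆ ∣   ≡⟨ cong (∣ p ∣ +_) (∣⁅x⁆∣≡1 x) ⟩
  ∣ p ∣ + 1           ≡⟨ +-comm ∣ p ∣ 1 ⟩
  suc ∣ p ∣           ∎
  where open ≡-Reasoning

∣⁅x⁆∪⁅y⁆∣≤2 : ∀ {n} (x y : Fin n) → ∣ ⁅ x ⁆ ∪ ⁅ y ⁆ ∣ ≤ 2
∣⁅x⁆∪⁅y⁆∣≤2 x y = ≤-trans (∣p∪q∣≤∣p∣+∣q∣ ⁅ x ⁆ ⁅ y ⁆) (≤-reflexive (cong₂ _+_ (∣⁅x⁆∣≡1 x) (∣⁅x⁆∣≡1 y)))

∣⁅x⁆∪⁅y⁆∣≡2 : ∀ {n} {x y : Fin n} → x ≢ y → ∣ ⁅ x ⁆ ∪ ⁅ y ⁆ ∣ ≡ 2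
∣⁅x⁆∪⁅y⁆∣≡2 {x = x} {y} x≢y =
  trans (∣p∪⁅x⁆∣≡1+∣p∣ ⁅ x ⁆ y λ y∈ → x≢y (sym (x∈⁅y⁆⇒x≡y _ y∈))) (cong suc (∣⁅x⁆∣≡1 x))

⁅x⁆∪⁅y⁆⊆p : ∀ {n} {x y : Fin n} {p : Subset n} → x ∈ p → y ∈ p → ⁅ x ⁆ ∪ ⁅ y ⁆ ⊆ p
⁅x⁆∪⁅y⁆⊆p {p = p} x∈p y∈p z∈ =
  [ (λ z∈x → subst (_∈ p) (sym (x∈⁅y⁆⇒x≡y _ z∈x)) x∈p)
  , (λ z∈y → subst (_∈ p) (sym (x∈⁅y⁆⇒x≡y _ z∈y)) y∈p) ]′ (x∈p∪q⁻ _ _ z∈)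

two-elements⇒2≤∣p∣ : ∀ {n} {x y : Fin n} {p : Subset n} → x ∈ p → y ∈ p → x ≢ y → 2 ≤ ∣ p ∣
two-elements⇒2≤∣p∣ x∈p y∈p x≢y =
  subst (_≤ _) (∣⁅x⁆∪⁅y⁆∣≡2 x≢y) (p⊆q⇒∣p∣≤∣q∣ (⁅x⁆∪⁅y⁆⊆p x∈p y∈p))

three-elements⇒3≤∣p∣ : ∀ {n} {x y z : Fin n} {p : Subset n} → x ∈ p → y ∈ p → z ∈ p →
                       x ≢ y → x ≢ z → y ≢ z → 3 ≤ ∣ p ∣
three-elements⇒3≤∣p∣ {x = x} {y} {z} {p} x∈p y∈p z∈p x≢y x≢z y≢z =
  subst (_≤ ∣ p ∣) ∣xyz∣≡3 (p⊆q⇒∣p∣≤∣q∣ xyz⊆p)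
  where
  z∉xy : z ∉ ⁅ x ⁆ ∪ ⁅ y ⁆
  z∉xy z∈ = [ (λ z∈x → x≢z (sym (x∈⁅y⁆⇒x≡y _ z∈x))) , (λ z∈y → y≢z (sym (x∈⁅y⁆⇒x≡y _ z∈y))) ]′
              (x∈p∪q⁻ _ _ z∈)
  ∣xyz∣≡3 : ∣ (⁅ x ⁆ ∪ ⁅ y ⁆) ∪ ⁅ z ⁆ ∣ ≡ 3
  ∣xyz∣≡3 = trans (∣p∪⁅x⁆∣≡1+∣p∣ _ z z∉xy) (cong suc (∣⁅x⁆∪⁅y⁆∣≡2 x≢y))
  xyz⊆p : (⁅ x ⁆ ∪ ⁅ y ⁆) ∪ ⁅ z ⁆ ⊆ p
  xyz⊆p w∈ = [ ⁅x⁆∪⁅y⁆⊆p x∈p y∈p , (λ w∈z → subst (_∈ p) (sym (x∈⁅y⁆⇒x≡y _ w∈z)) z∈p) ]′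
               (x∈p∪q⁻ _ _ w∈)

∣p∣<n⇒∃∉ : ∀ {n} (p : Subset n) → ∣ p ∣ < n → ∃ λ x → x ∉ p
∣p∣<n⇒∃∉ {n} p ∣p∣<n with nonempty? (∁ p)
... | yes (x , x∈∁p) = x , x∈∁p⇒x∉p x∈∁p
... | no ∁p-empty = ⊥-elim (<-irrefl (trans (cong ∣_∣ p≡⊤) (∣⊤∣≡n n)) ∣p∣<n)
  where
  p≡⊤ : p ≡ ⊤
  p≡⊤ = ⊆-antisym ⊆⊤ (λ {x} _ → x∉∁p⇒x∈p (λ x∈ → ∁p-empty (x , x∈)))

∈-tabulate⁺ : ∀ {n} {f : Fin n → Bool} {x} → f x ≡ true → x ∈ tabulate f
∈-tabulate⁺ {f = f} {x} fx = lookup⇒[]= x (tabulate f) (trans (lookup∘tabulate f x) fx)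

∈-tabulate⁻ : ∀ {n} {f : Fin n → Bool} {x} → x ∈ tabulate f → f x ≡ true
∈-tabulate⁻ {f = f} {x} x∈ = trans (sym (lookup∘tabulate f x)) ([]=⇒lookup x∈)

dec-true⁻ : ∀ {p} {P : Set p} (d : Dec P) → does d ≡ true → P
dec-true⁻ (yes p) _ = p

image : ∀ {r n} → (Fin r → Fin n) → Subset n
image f = tabulate λ v → does (any? (λ a → f a ≟ v))

∈-image⁺ : ∀ {r n} (f : Fin r → Fin n) a → f a ∈ image f
∈-image⁺ f a = ∈-tabulate⁺ (dec-true (any? (λ b → f b ≟ f a)) (a , refl))

∈-image⁻ : ∀ {r n} (f : Fin r → Fin n) {v} → v ∈ image f → ∃ λ a → f a ≡ v
∈-image⁻ f v∈ = dec-true⁻ (any? _) (∈-tabulate⁻ v∈)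

∣image∣≡ : ∀ {r n} (f : Fin r → Fin n) → Injective _≡_ _≡_ f → ∣ image f ∣ ≡ r
∣image∣≡ {zero} {n} f _ =
  trans (cong ∣_∣ (⊆-antisym (λ v∈ → ⊥-elim (Fin0-empty (proj₁ (∈-image⁻ f v∈)))) (λ v∈ → ⊥-elim (∉⊥ v∈))))
        (∣⊥∣≡0 n)
  where
  Fin0-empty : Fin 0 → ⊥
  Fin0-empty ()
∣image∣≡ {suc r} f f-inj = begin
  ∣ image f ∣                ≡⟨ cong ∣_∣ image-split ⟩
  ∣ image g ∪ ⁅ f fz ⁆ ∣     ≡⟨ ∣p∪⁅x⁆∣≡1+∣p∣ (image g) (f fz) f0∉ ⟩
  suc ∣ image g ∣            ≡⟨ cong suc (∣image∣≡ g (λ e → suc-injective (f-inj e))) ⟩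
  suc r                      ∎
  where
  open ≡-Reasoning
  g : Fin r → Fin _
  g a = f (fs a)
  f0∉ : f fz ∉ image g
  f0∉ f0∈ with ∈-image⁻ g f0∈
  ... | a , ga≡f0 with f-inj ga≡f0
  ... | ()
  split⊆ : ∀ {v} → ∃ (λ a → f a ≡ v) → v ∈ image g ∪ ⁅ f fz ⁆
  split⊆ (fz , refl) = x∈p∪q⁺ (inj₂ (x∈⁅x⁆ _))
  split⊆ (fs a , refl) = x∈p∪q⁺ (inj₁ (∈-image⁺ g a))
  image-split : image f ≡ image g ∪ ⁅ f fz ⁆
  image-split = ⊆-antisym (λ v∈ → split⊆ (∈-image⁻ f v∈))
    (λ v∈ → [ (λ v∈g → let (a , e) = ∈-image⁻ g v∈g in subst (_∈ image f) e (∈-image⁺ f (fs a)))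
            , (λ v∈0 → subst (_∈ image f) (sym (x∈⁅y⁆⇒x≡y _ v∈0)) (∈-image⁺ f fz)) ]′ (x∈p∪q⁻ _ _ v∈))

-- Finite sums

module ℕ-Sum = CommutativeMonoidSum +-0-commutativeMonoid

sumFin≡sum : ∀ {k} (f : Fin k → ℕ) → sumFin f ≡ ℕ-Sum.sum f
sumFin≡sum {zero} f = refl
sumFin≡sum {suc k} f = cong (f fz +_) (sumFin≡sum (λ i → f (fs i)))

sumFin-cong : ∀ {k} {f g : Fin k → ℕ} → (∀ i → f i ≡ g i) → sumFin f ≡ sumFin g
sumFin-cong {zero} f≗g = refl
sumFin-cong {suc k} f≗g = cong₂ _+_ (f≗g fz) (sumFin-cong (λ i → f≗g (fs i)))

sumFin-mono : ∀ {k} {f g : Fin k → ℕ} → (∀ i → f i ≤ g i) → sumFin f ≤ sumFin g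
sumFin-mono {zero} f≤g = z≤n
sumFin-mono {suc k} f≤g = +-mono-≤ (f≤g fz) (sumFin-mono (λ i → f≤g (fs i)))

sumFin-mono-< : ∀ {k} {f g : Fin k → ℕ} → (∀ i → f i ≤ g i) → ∀ j → f j < g j → sumFin f < sumFin g
sumFin-mono-< {suc k} f≤g fz fj<gj = +-mono-≤ fj<gj (sumFin-mono (λ i → f≤g (fs i)))
sumFin-mono-< {suc k} {f} {g} f≤g (fs j) fj<gj =
  subst (_≤ sumFin g) (+-suc (f fz) (sumFin (λ i → f (fs i))))
    (+-mono-≤ (f≤g fz) (sumFin-mono-< (λ i → f≤g (fs i)) j fj<gj))

sumFin-≥⇒pointwise-≥ : ∀ {k} {f g : Fin k → ℕ} → (∀ i → f i ≤ g i) → sumFin g ≤ sumFin f →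
                       ∀ i → g i ≤ f i
sumFin-≥⇒pointwise-≥ {f = f} {g} f≤g Σg≤Σf i with g i ≤? f i
... | yes gi≤fi = gi≤fi
... | no gi≰fi = ⊥-elim (<-irrefl refl (≤-trans (sumFin-mono-< f≤g i (≰⇒> gi≰fi)) Σg≤Σf))

sumFin-const : ∀ k c → sumFin {k} (λ _ → c) ≡ k * c
sumFin-const zero c = refl
sumFin-const (suc k) c = cong (c +_) (sumFin-const k c)

sumFin-+ : ∀ {k} (f g : Fin k → ℕ) → sumFin (λ i → f i + g i) ≡ sumFin f + sumFin g
sumFin-+ f g = begin
  sumFin (λ i → f i + g i)              ≡⟨ sumFin≡sum (λ i → f i + g i) ⟩
  ℕ-Sum.sum (λ i → f i + g i)           ≡⟨ ℕ-Sum.∑-distrib-+ f g ⟩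
  ℕ-Sum.sum f + ℕ-Sum.sum g             ≡⟨ cong₂ _+_ (sumFin≡sum f) (sumFin≡sum g) ⟨
  sumFin f + sumFin g                   ∎
  where open ≡-Reasoning

sumFin-+-const : ∀ {k} (f : Fin k → ℕ) c → sumFin (λ i → f i + c) ≡ sumFin f + k * c
sumFin-+-const {k} f c = trans (sumFin-+ f (λ _ → c)) (cong (sumFin f +_) (sumFin-const k c))

sumFin-comm : ∀ {k l} (f : Fin k → Fin l → ℕ) →
              sumFin (λ a → sumFin (λ b → f a b)) ≡ sumFin (λ b → sumFin (λ a → f a b))
sumFin-comm f = begin
  sumFin (λ a → sumFin (λ b → f a b))           ≡⟨ sumFin-cong (λ a → sumFin≡sum (f a)) ⟩
  sumFin (λ a → ℕ-Sum.sum (f a))                ≡⟨ sumFin≡sum (λ a → ℕ-Sum.sum (f a)) ⟩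
  ℕ-Sum.sum (λ a → ℕ-Sum.sum (f a))             ≡⟨ ℕ-Sum.∑-comm f ⟩
  ℕ-Sum.sum (λ b → ℕ-Sum.sum (λ a → f a b))     ≡⟨ sumFin≡sum (λ b → ℕ-Sum.sum (λ a → f a b)) ⟨
  sumFin (λ b → ℕ-Sum.sum (λ a → f a b))        ≡⟨ sumFin-cong (λ b → sumFin≡sum (λ a → f a b)) ⟨
  sumFin (λ b → sumFin (λ a → f a b))           ∎
  where open ≡-Reasoning

injective⇒surjective : ∀ {k} (σ : Fin k → Fin k) → Injective _≡_ _≡_ σ → ∀ y → ∃ λ x → σ x ≡ y
injective⇒surjective {zero} σ σ-inj ()
injective⇒surjective {suc k} σ σ-inj y with any? (λ x → σ x ≟ y)
... | yes hit = hit
... | no miss = ⊥-elim (<-irrefl refl (injective⇒≤ {f = squeeze} squeeze-inj))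
  where
  y≢σ : ∀ x → y ≢ σ x
  y≢σ x e = miss (x , sym e)
  squeeze : Fin (suc k) → Fin k
  squeeze x = punchOut (y≢σ x)
  squeeze-inj : Injective _≡_ _≡_ squeeze
  squeeze-inj {a} {b} e = σ-inj (punchOut-injective (y≢σ a) (y≢σ b) e)

sumFin-permute : ∀ {k} (σ : Fin k → Fin k) → Injective _≡_ _≡_ σ → (f : Fin k → ℕ) →
                 sumFin (λ i → f (σ i)) ≡ sumFin f
sumFin-permute {k} σ σ-inj f =
  trans (sumFin≡sum (λ i → f (σ i))) (trans (sym (ℕ-Sum.sum-permute f π)) (sym (sumFin≡sum f)))
  where
  σ⁻¹ : Fin k → Fin k
  σ⁻¹ y = proj₁ (injective⇒surjective σ σ-inj y)
  σσ⁻¹ : ∀ y → σ (σ⁻¹ y) ≡ y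
  σσ⁻¹ y = proj₂ (injective⇒surjective σ σ-inj y)
  π : Permutation k k
  π = permutation σ σ⁻¹ σσ⁻¹ (λ x → σ-inj (σσ⁻¹ (σ x)))

term≤sumFin : ∀ {k} (f : Fin k → ℕ) i → f i ≤ sumFin f
term≤sumFin f fz = m≤m+n _ _
term≤sumFin f (fs i) = ≤-trans (term≤sumFin (λ j → f (fs j)) i) (m≤n+m _ (f fz))

two-terms≤sumFin : ∀ {k} (f : Fin k → ℕ) i j → i ≢ j → f i + f j ≤ sumFin f
two-terms≤sumFin f fz fz i≢j = ⊥-elim (i≢j refl)
two-terms≤sumFin f fz (fs j) _ = +-monoʳ-≤ (f fz) (term≤sumFin (λ x → f (fs x)) j)
two-terms≤sumFin f (fs i) fz _ =
  ≤-trans (≤-reflexive (+-comm (f (fs i)) (f fz))) (+-monoʳ-≤ (f fz) (term≤sumFin (λ x → f (fs x)) i))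
two-terms≤sumFin f (fs i) (fs j) i≢j =
  ≤-trans (two-terms≤sumFin (λ x → f (fs x)) i j (λ e → i≢j (cong fs e))) (m≤n+m _ (f fz))

⋃ : ∀ {n k} → (Fin k → Subset n) → Subset n
⋃ {k = zero} B = ∅
⋃ {k = suc k} B = B fz ∪ ⋃ (λ i → B (fs i))

∈-⋃⁺ : ∀ {n k} (B : Fin k → Subset n) {x} i → x ∈ B i → x ∈ ⋃ B
∈-⋃⁺ {k = suc k} B fz x∈ = x∈p∪q⁺ (inj₁ x∈)
∈-⋃⁺ {k = suc k} B (fs i) x∈ = x∈p∪q⁺ (inj₂ (∈-⋃⁺ (λ j → B (fs j)) i x∈))

∣⋃∣≤sum : ∀ {n k} (B : Fin k → Subset n) → ∣ ⋃ B ∣ ≤ sumFin (λ i → ∣ B i ∣)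
∣⋃∣≤sum {n} {k = zero} B = ≤-reflexive (∣⊥∣≡0 n)
∣⋃∣≤sum {k = suc k} B =
  ≤-trans (∣p∪q∣≤∣p∣+∣q∣ (B fz) _) (+-monoʳ-≤ ∣ B fz ∣ (∣⋃∣≤sum (λ i → B (fs i))))

overlap⇒∣⋃∣<sum : ∀ {n k} (B : Fin k → Subset n) {x} (i j : Fin k) → i ≢ j → x ∈ B i → x ∈ B j →
                  ∣ ⋃ B ∣ < sumFin (λ i → ∣ B i ∣)
overlap⇒∣⋃∣<sum {k = suc k} B fz fz i≢j _ _ = ⊥-elim (i≢j refl)
overlap⇒∣⋃∣<sum {k = suc k} B fz (fs j) _ x∈i x∈j =
  ≤-trans (x∈p∩q⇒∣p∪q∣<∣p∣+∣q∣ (B fz) _ x∈i (∈-⋃⁺ (λ j → B (fs j)) j x∈j))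
          (+-monoʳ-≤ ∣ B fz ∣ (∣⋃∣≤sum (λ i → B (fs i))))
overlap⇒∣⋃∣<sum {k = suc k} B (fs i) fz _ x∈i x∈j =
  ≤-trans (x∈p∩q⇒∣p∪q∣<∣p∣+∣q∣ (B fz) _ x∈j (∈-⋃⁺ (λ j → B (fs j)) i x∈i))
          (+-monoʳ-≤ ∣ B fz ∣ (∣⋃∣≤sum (λ i → B (fs i))))
overlap⇒∣⋃∣<sum {k = suc k} B (fs i) (fs j) i≢j x∈i x∈j =
  ≤-trans (s≤s (∣p∪q∣≤∣p∣+∣q∣ (B fz) _))
    (subst (_≤ ∣ B fz ∣ + sumFin (λ i → ∣ B (fs i) ∣)) (+-suc ∣ B fz ∣ ∣ ⋃ (λ j → B (fs j)) ∣)
      (+-monoʳ-≤ ∣ B fz ∣ (overlap⇒∣⋃∣<sum (λ j → B (fs j)) i j (λ e → i≢j (cong fs e)) x∈i x∈j)))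

x+k≤k*R⇒x≤[R∸1]*k : ∀ x k R → x + k ≤ k * R → x ≤ (R ∸ 1) * k
x+k≤k*R⇒x≤[R∸1]*k x k zero x+k≤0 = ≤-trans (m≤m+n x k) (≤-trans x+k≤0 (≤-reflexive (*-zeroʳ k)))
x+k≤k*R⇒x≤[R∸1]*k x k (suc R) x+k≤k*R =
  +-cancelʳ-≤ k x (R * k) (≤-trans x+k≤k*R (≤-reflexive (solve 2 (λ k R → k :* (con 1 :+ R) := R :* k :+ k) refl k R)))

nullity-step : ∀ {ν t x s a T} r → 0 < r → x + s ≤ a + r → suc t ≤ s → ν + a ≤ (r ∸ 1) * T + 1 →
               ν + t + x ≤ (r ∸ 1) * suc T + 1
nullity-step {ν} {t} {x} {s} {a} {T} (suc R) _ x+s≤a+r t<s nullity = ≤-pred (begin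
  suc (ν + t + x)         ≡⟨ solve 3 (λ ν t x → con 1 :+ (ν :+ t :+ x) := ν :+ (con 1 :+ t) :+ x) refl ν t x ⟩
  ν + suc t + x           ≤⟨ +-monoˡ-≤ x (+-monoʳ-≤ ν t<s) ⟩
  ν + s + x               ≡⟨ solve 3 (λ ν s x → ν :+ s :+ x := ν :+ (x :+ s)) refl ν s x ⟩
  ν + (x + s)             ≤⟨ +-monoʳ-≤ ν x+s≤a+r ⟩
  ν + (a + suc R)         ≡⟨ +-assoc ν a (suc R) ⟨
  ν + a + suc R           ≤⟨ +-monoˡ-≤ (suc R) nullity ⟩
  R * T + 1 + suc R       ≡⟨ solve 2 (λ R T → R :* T :+ con 1 :+ (con 1 :+ R)
                                             := con 1 :+ (R :* (con 1 :+ T) :+ con 1)) refl R T ⟩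
  suc (R * suc T + 1)     ∎)
  where open ≤-Reasoning

<ᵇ≡true⇒< : ∀ {m n} → (m <ᵇ n) ≡ true → m < n
<ᵇ≡true⇒< {m} {n} m<ᵇn = <ᵇ⇒< m n (subst T (sym m<ᵇn) _)

<ᵇ≡false⇒≮ : ∀ {m n} → (m <ᵇ n) ≡ false → ¬ m < n
<ᵇ≡false⇒≮ m≮ᵇn m<n = subst T m≮ᵇn (<⇒<ᵇ m<n)

-- Counting pairs of a Boolean relation

indicator : Bool → ℕ
indicator true = 1
indicator false = 0

-- The summand of count is local to Defs and cannot be named: the left-hand side below is
-- solved by unification at the use in count≡sumFin, before the clauses are checked.
count-summand : ∀ {k} (f : Fin k → Bool) i → _ ≡ indicator (f i)

count≡sumFin : ∀ {k} (f : Fin k → Bool) → count f ≡ sumFin (λ i → indicator (f i))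
count≡sumFin f = sumFin-cong (count-summand f)

count-summand f i with f i
... | true = refl
... | false = refl

∣tabulate∣≡sumFin : ∀ {k} (g : Fin k → Bool) → ∣ tabulate g ∣ ≡ sumFin (λ i → indicator (g i))
∣tabulate∣≡sumFin {zero} g = refl
∣tabulate∣≡sumFin {suc k} g with g fz
... | true = cong suc (∣tabulate∣≡sumFin (λ i → g (fs i)))
... | false = ∣tabulate∣≡sumFin (λ i → g (fs i))

indicator-mono : ∀ {x y} → (x ≡ true → y ≡ true) → indicator x ≤ indicator y
indicator-mono {false} _ = z≤n
indicator-mono {true} x⇒y rewrite x⇒y refl = ≤-refl

indicator-≤⇒ : ∀ {x y} → x ≡ true → indicator x ≤ indicator y → y ≡ true
indicator-≤⇒ {y = true} _ _ = refl
indicator-≤⇒ {true} {false} _ ()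

Rel₂ : ℕ → Set
Rel₂ k = Fin k → Fin k → Bool

row : ∀ {k} → Rel₂ k → Fin k → ℕ
row R a = sumFin (λ b → indicator (R a b))

pairCount : ∀ {k} → Rel₂ k → ℕ
pairCount R = sumFin (row R)

pairCount-≤⇒⊇ : ∀ {k} (R S : Rel₂ k) → (∀ a b → R a b ≡ true → S a b ≡ true) → pairCount S ≤ pairCount R →
                ∀ a b → S a b ≡ true → R a b ≡ true
pairCount-≤⇒⊇ R S R⊆S S≤R a b Sab = indicator-≤⇒ Sab
  (sumFin-≥⇒pointwise-≥ (λ b → indicator-mono (R⊆S a b))
    (sumFin-≥⇒pointwise-≥ (λ a → sumFin-mono (λ b → indicator-mono (R⊆S a b))) S≤R a) b)

pairCount-permute : ∀ {k} (σ : Fin k → Fin k) → Injective _≡_ _≡_ σ → (R : Rel₂ k) →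
                    pairCount (λ a b → R (σ a) (σ b)) ≡ pairCount R
pairCount-permute σ σ-inj R =
  trans (sumFin-cong (λ a → sumFin-permute σ σ-inj (λ b → indicator (R (σ a) b))))
        (sumFin-permute σ σ-inj (row R))

pairCount-transpose : ∀ {k} (R : Rel₂ k) → pairCount R ≡ pairCount (λ a b → R b a)
pairCount-transpose R = sumFin-comm (λ a b → indicator (R a b))

pairCount-split : ∀ {k} (R S : Rel₂ k) →
                  pairCount R ≡ pairCount (λ u v → R u v ∧ S u v) + pairCount (λ u v → R u v ∧ not (S u v))
pairCount-split R S =
  trans (sumFin-cong (λ u → trans (sumFin-cong (λ v → indicator-split (R u v) (S u v)))
                                  (sumFin-+ (λ v → indicator (R u v ∧ S u v)) (λ v → indicator (R u v ∧ not (S u v))))))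
        (sumFin-+ (row (λ u v → R u v ∧ S u v)) (row (λ u v → R u v ∧ not (S u v))))
  where
  indicator-split : ∀ x y → indicator x ≡ indicator (x ∧ y) + indicator (x ∧ not y)
  indicator-split true true = refl
  indicator-split true false = refl
  indicator-split false y = refl

0<pairCount⇒∃ : ∀ {k} (R : Rel₂ k) → 0 < pairCount R → ∃ λ a → ∃ λ b → R a b ≡ true
0<pairCount⇒∃ R 0<count with any? (λ a → any? (λ b → R a b ≟ᵇ true))
... | yes witness = witness
... | no none = ⊥-elim (<-irrefl refl (≤-trans 0<count (≤-reflexive (sumFin-zero λ a → sumFin-zero (row-entry a)))))
  where
  row-entry : ∀ a b → indicator (R a b) ≡ 0
  row-entry a b with R a b in Rab
  ... | false = refl
  ... | true = ⊥-elim (none (a , b , Rab))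
  sumFin-zero : ∀ {k} {g : Fin k → ℕ} → (∀ i → g i ≡ 0) → sumFin g ≡ 0
  sumFin-zero {zero} _ = refl
  sumFin-zero {suc k} g≗0 = cong₂ _+_ (g≗0 fz) (sumFin-zero (λ i → g≗0 (fs i)))

entry≤row : ∀ {k} (R : Rel₂ k) {a b} → R a b ≡ true → 1 ≤ row R a
entry≤row R {a} {b} Rab = ≤-trans (≤-reflexive (cong indicator (sym Rab))) (term≤sumFin (λ v → indicator (R a v)) b)

row≡∣tabulate∣ : ∀ {k} (R : Rel₂ k) a → row R a ≡ ∣ tabulate (R a) ∣
row≡∣tabulate∣ R a = sym (∣tabulate∣≡sumFin (R a))

row≤1 : ∀ {k} (R : Rel₂ k) a w → (∀ v → R a v ≡ true → v ≡ w) → row R a ≤ 1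
row≤1 R a w only-w = ≤-trans (≤-reflexive (row≡∣tabulate∣ R a))
  (≤-trans (p⊆q⇒∣p∣≤∣q∣ λ {v} v∈ → subst (_∈ ⁅ w ⁆) (sym (only-w v (∈-tabulate⁻ v∈))) (x∈⁅x⁆ w))
           (≤-reflexive (∣⁅x⁆∣≡1 w)))

row≡0 : ∀ {k} (R : Rel₂ k) a → (∀ v → R a v ≡ true → ⊥) → row R a ≡ 0
row≡0 {k} R a empty = trans (row≡∣tabulate∣ R a)
  (trans (cong ∣_∣ (Empty-unique λ (v , v∈) → empty v (∈-tabulate⁻ v∈))) (∣⊥∣≡0 k))

∣p∣≡sumFin : ∀ {k} (p : Subset k) → ∣ p ∣ ≡ sumFin (λ x → indicator (does (x ∈? p)))
∣p∣≡sumFin p = trans (cong ∣_∣ p≡tabulate) (∣tabulate∣≡sumFin (λ x → does (x ∈? p)))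
  where
  p≡tabulate : p ≡ tabulate (λ x → does (x ∈? p))
  p≡tabulate = ⊆-antisym (λ {x} x∈ → ∈-tabulate⁺ (dec-true (x ∈? p) x∈))
                         (λ {x} x∈ → dec-true⁻ (x ∈? p) (∈-tabulate⁻ x∈))

∣p∣≤sum-over-p : ∀ {k} (p : Subset k) (f : Fin k → ℕ) → (∀ x → x ∈ p → 1 ≤ f x) → ∣ p ∣ ≤ sumFin f
∣p∣≤sum-over-p p f positive-on-p =
  ≤-trans (≤-reflexive (∣p∣≡sumFin p)) (sumFin-mono (λ x → bound x (x ∈? p)))
  where
  bound : ∀ x (d : Dec (x ∈ p)) → indicator (does d) ≤ f x
  bound x (yes x∈) = positive-on-p x x∈
  bound x (no _) = z≤n

sum≤∣p∣ : ∀ {k} (p : Subset k) (f : Fin k → ℕ) → (∀ x → f x ≤ 1) → (∀ x → x ∉ p → f x ≡ 0) → sumFin f ≤ ∣ p ∣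
sum≤∣p∣ p f ≤1 zero-outside-p =
  ≤-trans (sumFin-mono (λ x → bound x (x ∈? p))) (≤-reflexive (sym (∣p∣≡sumFin p)))
  where
  bound : ∀ x (d : Dec (x ∈ p)) → f x ≤ indicator (does d)
  bound x (yes _) = ≤1 x
  bound x (no x∉p) = ≤-reflexive (zero-outside-p x x∉p)

-- Graphs

module _ {r} {F : Graph r} where

  adjacent⇒≢ : ∀ {a b} → adj F a b ≡ true → a ≢ b
  adjacent⇒≢ {a} ab refl with trans (sym (irrefl F a)) ab
  ... | ()

  walk-end∉ : ∀ {X u t} → Walk F X u t → u ∉ X → t ∉ X
  walk-end∉ here u∉X = u∉X
  walk-end∉ (step _ _ t∉X) _ = t∉X

  walk-preserves : ∀ {X s t} (P : Fin r → Set) → (∀ {u w} → adj F u w ≡ true → w ∉ X → P u → P w) →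
                   Walk F X s t → P s → P t
  walk-preserves P closed here Ps = Ps
  walk-preserves P closed (step walk uw w∉X) Ps = closed uw w∉X (walk-preserves P closed walk Ps)

  walk-leaves : ∀ {X s t} (P : Fin r → Set) → (∀ v → Dec (P v)) → Walk F X s t → P s → ¬ P t →
                ∃ λ u → ∃ λ w → adj F u w ≡ true × P u × ¬ P w
  walk-leaves P P? walk Ps ¬Pt with any? (λ u → any? (λ w → (adj F u w ≟ᵇ true) ×-dec (P? u ×-dec ¬? (P? w))))
  ... | yes crossing = crossing
  ... | no none = ⊥-elim (¬Pt (walk-preserves P closed walk Ps))
    where
    closed : ∀ {u w} → adj F u w ≡ true → w ∉ _ → P u → P w
    closed {u} {w} uw _ Pu = decidable-stable (P? w) λ ¬Pw → none (u , w , uw , Pu , ¬Pw)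

  connected : ∀ {k} → KConnected (suc k) F → ∀ u v → Walk F ∅ u v
  connected {k} (_ , conn) u v = conn ∅ (subst (_< suc k) (sym (∣⊥∣≡0 r)) (s≤s z≤n)) u v ∉⊥ ∉⊥

  connected-minus : KConnected 2 F → ∀ c u v → u ≢ c → v ≢ c → Walk F ⁅ c ⁆ u v
  connected-minus (_ , conn) c u v u≢c v≢c =
    conn ⁅ c ⁆ (s≤s (≤-reflexive (∣⁅x⁆∣≡1 c))) u v (λ u∈ → u≢c (x∈⁅y⁆⇒x≡y _ u∈)) (λ v∈ → v≢c (x∈⁅y⁆⇒x≡y _ v∈))

  connected-minus-two : KConnected 3 F → ∀ c d u v → u ∉ ⁅ c ⁆ ∪ ⁅ d ⁆ → v ∉ ⁅ c ⁆ ∪ ⁅ d ⁆ →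
                        Walk F (⁅ c ⁆ ∪ ⁅ d ⁆) u v
  connected-minus-two (_ , conn) c d = conn (⁅ c ⁆ ∪ ⁅ d ⁆) (s≤s (∣⁅x⁆∪⁅y⁆∣≤2 c d))

  other-vertex : ∀ {k} → KConnected k F → (X : Subset r) → ∣ X ∣ ≤ k → ∃ λ v → v ∉ X
  other-vertex (k<r , _) X ∣X∣≤k = ∣p∣<n⇒∃∉ X (≤-<-trans ∣X∣≤k k<r)

  neighbour-avoiding : KConnected 2 F → ∀ a b → a ≢ b → ∃ λ c → adj F c a ≡ true × c ≢ b
  neighbour-avoiding k2 a b a≢b with other-vertex k2 (⁅ a ⁆ ∪ ⁅ b ⁆) (∣⁅x⁆∪⁅y⁆∣≤2 a b)
  ... | d , d∉ = last-step d≢a d∉b (connected-minus k2 b d a d≢b a≢b)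
    where
    d≢a : d ≢ a
    d≢a refl = d∉ (x∈p∪q⁺ (inj₁ (x∈⁅x⁆ d)))
    d≢b : d ≢ b
    d≢b refl = d∉ (x∈p∪q⁺ (inj₂ (x∈⁅x⁆ d)))
    d∉b : d ∉ ⁅ b ⁆
    d∉b d∈ = d≢b (x∈⁅y⁆⇒x≡y _ d∈)
    last-step : ∀ {s} → s ≢ a → s ∉ ⁅ b ⁆ → Walk F ⁅ b ⁆ s a → ∃ λ c → adj F c a ≡ true × c ≢ b
    last-step s≢a _ here = ⊥-elim (s≢a refl)
    last-step _ s∉b (step {v} walk va _) =
      v , va , λ v≡b → walk-end∉ walk s∉b (subst (_∈ ⁅ b ⁆) (sym v≡b) (x∈⁅x⁆ b))

  neighbour : KConnected 2 F → ∀ a → ∃ λ b → adj F b a ≡ true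
  neighbour k2 a with other-vertex k2 ⁅ a ⁆ (≤-trans (≤-reflexive (∣⁅x⁆∣≡1 a)) (s≤s z≤n))
  ... | c , c∉ with neighbour-avoiding k2 a c (λ a≡c → c∉ (subst (_∈ ⁅ a ⁆) a≡c (x∈⁅x⁆ a)))
  ... | b , ba , _ = b , ba

  two-neighbours : KConnected 2 F → ∀ a → ∃ λ b → ∃ λ c → adj F b a ≡ true × adj F c a ≡ true × b ≢ c
  two-neighbours k2 a with neighbour k2 a
  ... | b , ba with neighbour-avoiding k2 a b (adjacent⇒≢ (trans (adj-sym F a b) ba))
  ... | c , ca , c≢b = b , c , ba , ca , λ b≡c → c≢b (sym b≡c)

  ascendingAdj : Rel₂ r
  ascendingAdj a b = (toℕ a <ᵇ toℕ b) ∧ adj F a b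

  numEdges≡pairCount : numEdges F ≡ pairCount ascendingAdj
  numEdges≡pairCount = sumFin-cong (λ a → count≡sumFin (ascendingAdj a))

  indicator-adj-split : ∀ a b → indicator (adj F a b) ≡ indicator (ascendingAdj a b) + indicator (ascendingAdj b a)
  indicator-adj-split a b with toℕ a <ᵇ toℕ b in a<b | toℕ b <ᵇ toℕ a in b<a
  ... | true | true = ⊥-elim (<-asym (<ᵇ≡true⇒< {toℕ a} a<b) (<ᵇ≡true⇒< {toℕ b} b<a))
  ... | true | false = sym (+-identityʳ _)
  ... | false | true = cong indicator (adj-sym F a b)
  ... | false | false = cong indicator (subst (λ x → adj F a x ≡ false) a≡b (irrefl F a))
    where
    a≡b : a ≡ b
    a≡b = toℕ-injective (≤∧≮⇒≡ (≮⇒≥ (<ᵇ≡false⇒≮ {toℕ b} b<a)) (<ᵇ≡false⇒≮ {toℕ a} a<b))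

  pairCount-adj≡2*numEdges : pairCount (adj F) ≡ numEdges F + numEdges F
  pairCount-adj≡2*numEdges = begin
    pairCount (adj F)
      ≡⟨ sumFin-cong (λ a → trans (sumFin-cong (indicator-adj-split a))
                                  (sumFin-+ (λ b → indicator (ascendingAdj a b)) (λ b → indicator (ascendingAdj b a)))) ⟩
    sumFin (λ a → row ascendingAdj a + row (λ a b → ascendingAdj b a) a)
      ≡⟨ sumFin-+ (row ascendingAdj) (row (λ a b → ascendingAdj b a)) ⟩
    pairCount ascendingAdj + pairCount (λ a b → ascendingAdj b a)
      ≡⟨ cong (pairCount ascendingAdj +_) (pairCount-transpose ascendingAdj) ⟨
    pairCount ascendingAdj + pairCount ascendingAdj
      ≡⟨ cong₂ _+_ numEdges≡pairCount numEdges≡pairCount ⟨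
    numEdges F + numEdges F ∎
    where open ≡-Reasoning

  2≤degree : KConnected 2 F → ∀ a → 2 ≤ row (adj F) a
  2≤degree k2 a = subst (2 ≤_) (sym (row≡∣tabulate∣ (adj F) a))
    (two-elements⇒2≤∣p∣ (∈-tabulate⁺ {f = adj F a} ab) (∈-tabulate⁺ {f = adj F a} ac) b≢c)
    where
    neighbours = two-neighbours k2 a
    b = proj₁ neighbours
    c = proj₁ (proj₂ neighbours)
    ab : adj F a b ≡ true
    ab = trans (adj-sym F a b) (proj₁ (proj₂ (proj₂ neighbours)))
    ac : adj F a c ≡ true
    ac = trans (adj-sym F a c) (proj₁ (proj₂ (proj₂ (proj₂ neighbours))))
    b≢c : b ≢ c
    b≢c = proj₂ (proj₂ (proj₂ (proj₂ neighbours)))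

  vertices≤edges : KConnected 2 F → r ≤ numEdges F
  vertices≤edges k2 = *-cancelˡ-≤ 2 (begin
    2 * r                      ≡⟨ *-comm 2 r ⟩
    r * 2                      ≡⟨ sumFin-const r 2 ⟨
    sumFin {r} (λ _ → 2)       ≤⟨ sumFin-mono (2≤degree k2) ⟩
    pairCount (adj F)          ≡⟨ pairCount-adj≡2*numEdges ⟩
    numEdges F + numEdges F    ≡⟨ cong (numEdges F +_) (+-identityʳ _) ⟨
    2 * numEdges F             ∎)
    where open ≤-Reasoning

SamePair : ∀ {k} → Fin k → Fin k → Fin k → Fin k → Set
SamePair u v x y = (u ≡ x × v ≡ y) ⊎ (u ≡ y × v ≡ x)

samePair? : ∀ {k} (u v x y : Fin k) → Dec (SamePair u v x y)
samePair? u v x y = ((u ≟ x) ×-dec (v ≟ y)) ⊎-dec ((u ≟ y) ×-dec (v ≟ x))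

SamePair⇒isPair : ∀ {k} {x y u v : Fin k} → SamePair u v x y → isPair x y u v ≡ true
SamePair⇒isPair {x = x} {y} (inj₁ (refl , refl)) rewrite dec-true (x ≟ x) refl | dec-true (y ≟ y) refl = refl
SamePair⇒isPair {x = x} {y} (inj₂ (refl , refl))
  rewrite dec-true (x ≟ x) refl | dec-true (y ≟ y) refl = ∨-zeroʳ (does (x ≟ y) ∧ does (y ≟ x))

¬SamePair⇒isPair : ∀ {k} {x y u v : Fin k} → ¬ SamePair u v x y → isPair x y u v ≡ false
¬SamePair⇒isPair {x = x} {y} {u} {v} ¬same with x ≟ u | y ≟ v | x ≟ v | y ≟ u
... | yes refl | yes refl | _ | _ = ⊥-elim (¬same (inj₁ (refl , refl)))
... | _ | _ | yes refl | yes refl = ⊥-elim (¬same (inj₂ (refl , refl)))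
... | no _ | _ | no _ | _ = refl
... | no _ | _ | yes _ | no _ = refl
... | yes _ | no _ | no _ | _ = refl
... | yes _ | no _ | yes _ | no _ = refl

isPair-permute : ∀ {k} (σ : Fin k → Fin k) → Injective _≡_ _≡_ σ → ∀ x y u v →
                 isPair (σ x) (σ y) (σ u) (σ v) ≡ isPair x y u v
isPair-permute σ σ-inj x y u v with samePair? u v x y
... | yes same = trans (SamePair⇒isPair (Sum.map σ-both σ-both same)) (sym (SamePair⇒isPair same))
  where
  σ-both : ∀ {u v x y} → u ≡ x × v ≡ y → σ u ≡ σ x × σ v ≡ σ y
  σ-both (u≡x , v≡y) = cong σ u≡x , cong σ v≡y
... | no ¬same = trans (¬SamePair⇒isPair λ same → ¬same (Sum.map σ⁻¹-both σ⁻¹-both same)) (sym (¬SamePair⇒isPair ¬same))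
  where
  σ⁻¹-both : ∀ {u v x y} → σ u ≡ σ x × σ v ≡ σ y → u ≡ x × v ≡ y
  σ⁻¹-both (σu≡σx , σv≡σy) = σ-inj σu≡σx , σ-inj σv≡σy

SamePair⇒adj≡ : ∀ {r} (F : Graph r) {u v x y} → SamePair u v x y → adj F u v ≡ adj F x y
SamePair⇒adj≡ F (inj₁ (refl , refl)) = refl
SamePair⇒adj≡ F {x = x} {y} (inj₂ (refl , refl)) = adj-sym F y x

relabelling-swap :
  ∀ {r} (F : Graph r) (σ : Fin r → Fin r) → Injective _≡_ _≡_ σ → ∀ {a b c d} →
  adj F a b ≡ true → adj F c d ≡ false →
  (∀ u v → adj F u v ≡ true → adj F (σ u) (σ v) ≡ false → SamePair u v a b) →
  (∀ u v → adj F (σ u) (σ v) ≡ true → adj F u v ≡ false → SamePair u v c d) →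
  ∀ u v → swapAdj F (σ a) (σ b) (σ c) (σ d) (σ u) (σ v) ≡ adj F u v
relabelling-swap F σ σ-inj {a} {b} {c} {d} ab cd only-ab only-cd u v = begin
  swapAdj F (σ a) (σ b) (σ c) (σ d) (σ u) (σ v)
    ≡⟨ cong₂ (λ x y → (Q ∧ not x) ∨ y) (isPair-permute σ σ-inj c d u v) (isPair-permute σ σ-inj a b u v) ⟩
  (Q ∧ not (isPair c d u v)) ∨ isPair a b u v
    ≡⟨ by-cases (samePair? u v a b) (samePair? u v c d) ⟩
  adj F u v ∎
  where
  open ≡-Reasoning
  Q = adj F (σ u) (σ v)
  unchanged : ∀ q p → Q ≡ q → adj F u v ≡ p → ¬ SamePair u v a b → ¬ SamePair u v c d → q ≡ p
  unchanged true true _ _ _ _ = refl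
  unchanged false false _ _ _ _ = refl
  unchanged true false Quv Puv _ uv≉cd = ⊥-elim (uv≉cd (only-cd u v Quv Puv))
  unchanged false true Quv Puv uv≉ab _ = ⊥-elim (uv≉ab (only-ab u v Puv Quv))
  by-cases : Dec (SamePair u v a b) → Dec (SamePair u v c d) → (Q ∧ not (isPair c d u v)) ∨ isPair a b u v ≡ adj F u v
  by-cases (yes uv≐ab) _ = begin
    (Q ∧ not (isPair c d u v)) ∨ isPair a b u v  ≡⟨ cong ((Q ∧ not (isPair c d u v)) ∨_) (SamePair⇒isPair uv≐ab) ⟩
    (Q ∧ not (isPair c d u v)) ∨ true            ≡⟨ ∨-zeroʳ _ ⟩
    true                                         ≡⟨ ab ⟨
    adj F a b                                    ≡⟨ SamePair⇒adj≡ F uv≐ab ⟨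
    adj F u v                                    ∎
  by-cases (no uv≉ab) (yes uv≐cd) = begin
    (Q ∧ not (isPair c d u v)) ∨ isPair a b u v  ≡⟨ cong₂ (λ x y → (Q ∧ not x) ∨ y) (SamePair⇒isPair uv≐cd)
                                                                                   (¬SamePair⇒isPair uv≉ab) ⟩
    (Q ∧ false) ∨ false                          ≡⟨ trans (∨-identityʳ _) (∧-zeroʳ Q) ⟩
    false                                        ≡⟨ cd ⟨
    adj F c d                                    ≡⟨ SamePair⇒adj≡ F uv≐cd ⟨
    adj F u v                                    ∎
  by-cases (no uv≉ab) (no uv≉cd) = begin
    (Q ∧ not (isPair c d u v)) ∨ isPair a b u v  ≡⟨ cong₂ (λ x y → (Q ∧ not x) ∨ y) (¬SamePair⇒isPair uv≉cd)
                                                                                   (¬SamePair⇒isPair uv≉ab) ⟩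
    (Q ∧ true) ∨ false                           ≡⟨ trans (∨-identityʳ _) (∧-identityʳ Q) ⟩
    Q                                            ≡⟨ unchanged Q (adj F u v) refl refl uv≉ab uv≉cd ⟩
    adj F u v                                    ∎

pairCount-one-pair≤2 : ∀ {k} (R : Rel₂ k) {a b} → a ≢ b → (∀ u v → R u v ≡ true → SamePair u v a b) → pairCount R ≤ 2
pairCount-one-pair≤2 R {a} {b} a≢b only-ab =
  ≤-trans (sum≤∣p∣ (⁅ a ⁆ ∪ ⁅ b ⁆) (row R) row≤1' row-outside) (∣⁅x⁆∪⁅y⁆∣≤2 a b)
  where
  row≤1' : ∀ u → row R u ≤ 1
  row≤1' u with u ≟ a
  ... | yes refl = row≤1 R u b λ v Ruv → [ proj₂ , (λ (u≡b , _) → ⊥-elim (a≢b u≡b)) ]′ (only-ab u v Ruv)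
  ... | no u≢a = row≤1 R u a λ v Ruv → [ (λ (u≡a , _) → ⊥-elim (u≢a u≡a)) , proj₂ ]′ (only-ab u v Ruv)
  row-outside : ∀ u → u ∉ ⁅ a ⁆ ∪ ⁅ b ⁆ → row R u ≡ 0
  row-outside u u∉ = row≡0 R u λ v Ruv →
    u∉ ([ (λ (u≡a , _) → x∈p∪q⁺ (inj₁ (subst (_∈ ⁅ a ⁆) (sym u≡a) (x∈⁅x⁆ a))))
        , (λ (u≡b , _) → x∈p∪q⁺ (inj₂ (subst (_∈ ⁅ b ⁆) (sym u≡b) (x∈⁅x⁆ b)))) ]′ (only-ab u v Ruv))

symmetric-pairCount≤2⇒one-pair : ∀ {k} (R : Rel₂ k) → (∀ u v → R u v ≡ R v u) → pairCount R ≤ 2 →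
                                 ∀ {c d} → c ≢ d → R c d ≡ true → ∀ u v → R u v ≡ true → SamePair u v c d
symmetric-pairCount≤2⇒one-pair R R-sym count≤2 {c} {d} c≢d Rcd u v Ruv =
  decidable-stable (samePair? u v c d) λ ¬same → <-irrefl refl (≤-trans (3≤pairCount ¬same) count≤2)
  where
  Rdc : R d c ≡ true
  Rdc = trans (R-sym d c) Rcd
  two-in-row : ∀ {a b b'} → R a b ≡ true → R a b' ≡ true → b ≢ b' → 2 ≤ row R a
  two-in-row {a} Rab Rab' b≢b' = subst (2 ≤_) (sym (row≡∣tabulate∣ R a))
    (two-elements⇒2≤∣p∣ (∈-tabulate⁺ {f = R a} Rab) (∈-tabulate⁺ {f = R a} Rab') b≢b')
  3≤pairCount : ¬ SamePair u v c d → 3 ≤ pairCount R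
  3≤pairCount ¬same with u ≟ c | u ≟ d
  ... | yes refl | _ = ≤-trans (+-mono-≤ (two-in-row Rcd Ruv λ d≡v → ¬same (inj₁ (refl , sym d≡v))) (entry≤row R Rdc))
                               (two-terms≤sumFin (row R) c d c≢d)
  ... | no _ | yes refl = ≤-trans (+-mono-≤ (two-in-row Rdc Ruv λ c≡v → ¬same (inj₂ (refl , sym c≡v))) (entry≤row R Rcd))
                                  (two-terms≤sumFin (row R) d c (λ d≡c → c≢d (sym d≡c)))
  ... | no u≢c | no u≢d =
    ≤-trans (three-elements⇒3≤∣p∣ {p = cdu} (x∈p∪q⁺ (inj₁ (x∈p∪q⁺ (inj₁ (x∈⁅x⁆ c)))))
                                             (x∈p∪q⁺ (inj₁ (x∈p∪q⁺ (inj₂ (x∈⁅x⁆ d)))))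
                                             (x∈p∪q⁺ (inj₂ (x∈⁅x⁆ u)))
                                             c≢d (λ c≡u → u≢c (sym c≡u)) (λ d≡u → u≢d (sym d≡u)))
            (∣p∣≤sum-over-p cdu (row R) nonzero-row)
    where
    cdu = (⁅ c ⁆ ∪ ⁅ d ⁆) ∪ ⁅ u ⁆
    nonzero-row : ∀ y → y ∈ cdu → 1 ≤ row R y
    nonzero-row y y∈ with x∈p∪q⁻ _ _ y∈
    ... | inj₂ y∈u = subst (λ y → 1 ≤ row R y) (sym (x∈⁅y⁆⇒x≡y _ y∈u)) (entry≤row R Ruv)
    ... | inj₁ y∈cd with x∈p∪q⁻ _ _ y∈cd
    ... | inj₁ y∈c = subst (λ y → 1 ≤ row R y) (sym (x∈⁅y⁆⇒x≡y _ y∈c)) (entry≤row R Rcd)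
    ... | inj₂ y∈d = subst (λ y → 1 ≤ row R y) (sym (x∈⁅y⁆⇒x≡y _ y∈d)) (entry≤row R Rdc)

-- Sub-hypergraphs of an F-graph

suc-r≤2*rC2 : ∀ {r} → 2 < r → suc r ≤ 2 * (r C 2)
suc-r≤2*rC2 {suc (suc zero)} (s≤s (s≤s ()))
suc-r≤2*rC2 {suc (suc (suc t))} _ = begin
  suc (3 + t)                                   ≡⟨ +-comm 1 (3 + t) ⟩
  (3 + t) + 1                                   ≤⟨ +-mono-≤ (≤-trans (m≤m+n (3 + t) t)
                                                     (≤-reflexive (cong (suc ∘ suc) (sym (+-suc t t))))) (s≤s z≤n) ⟩
  X + X                                         ≡⟨ cong (X +_) (+-identityʳ X) ⟨
  2 * X                                         ≤⟨ *-monoʳ-≤ 2 (+-monoʳ-≤ (2 + t)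
                                                     (≤-trans (≤-reflexive (sym (nC1≡n (1 + t)))) (m≤m+n _ _))) ⟩
  2 * ((2 + t) + ((1 + t) C 1 + (1 + t) C 2))   ≡⟨ cong (λ y → 2 * ((2 + t) + y)) (nCk+nC[k+1]≡[n+1]C[k+1] (1 + t) 1) ⟩
  2 * ((2 + t) + (2 + t) C 2)                   ≡⟨ cong (λ y → 2 * (y + (2 + t) C 2)) (nC1≡n (2 + t)) ⟨
  2 * ((2 + t) C 1 + (2 + t) C 2)               ≡⟨ cong (2 *_) (nCk+nC[k+1]≡[n+1]C[k+1] (2 + t) 1) ⟩
  2 * ((3 + t) C 2)                             ∎
  where
  open ≤-Reasoning
  X = (2 + t) + (1 + t)

module Hypergraph {r n m} {F : Graph r} (H : FGraph F n m) where

  vertexSet : Fin m → Subset n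
  vertexSet i = image (emb (fedge H i))

  InHE⇒∈ : ∀ {i v} → InHE H i v → v ∈ vertexSet i
  InHE⇒∈ {i} (a , φa≡v) = subst (_∈ vertexSet i) φa≡v (∈-image⁺ _ a)

  ∈⇒InHE : ∀ {i v} → v ∈ vertexSet i → InHE H i v
  ∈⇒InHE v∈ = ∈-image⁻ _ v∈

  ∣vertexSet∣≡r : ∀ i → ∣ vertexSet i ∣ ≡ r
  ∣vertexSet∣≡r i = ∣image∣≡ _ (embInj (fedge H i))

  ∈subVerts⁺ : ∀ {S i v} → i ∈ S → InHE H i v → v ∈ subVerts H S
  ∈subVerts⁺ {S} {i} {v} i∈S v∈i =
    ∈-tabulate⁺ (dec-true (any? (λ j → (j ∈? S) ×-dec any? (λ a → emb (fedge H j) a ≟ v))) (i , i∈S , v∈i))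

  ∈subVerts⁻ : ∀ {S v} → v ∈ subVerts H S → ∃ λ i → i ∈ S × InHE H i v
  ∈subVerts⁻ v∈ = dec-true⁻ (any? _) (∈-tabulate⁻ v∈)

  subVerts-mono : ∀ {S S'} → S ⊆ S' → subVerts H S ⊆ subVerts H S'
  subVerts-mono S⊆S' v∈ with ∈subVerts⁻ v∈
  ... | i , i∈S , v∈i = ∈subVerts⁺ (S⊆S' i∈S) v∈i

  subVerts-∪⁅⁆ : ∀ T e → subVerts H (T ∪ ⁅ e ⁆) ⊆ subVerts H T ∪ vertexSet e
  subVerts-∪⁅⁆ T e v∈ with ∈subVerts⁻ v∈
  ... | i , i∈ , v∈i with x∈p∪q⁻ T ⁅ e ⁆ i∈
  ... | inj₁ i∈T = x∈p∪q⁺ (inj₁ (∈subVerts⁺ i∈T v∈i))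
  ... | inj₂ i∈e = x∈p∪q⁺ (inj₂ (InHE⇒∈ (subst (λ j → InHE H j _) (x∈⁅y⁆⇒x≡y _ i∈e) v∈i)))

  subVerts-⁅⁆ : ∀ e → subVerts H ⁅ e ⁆ ⊆ vertexSet e
  subVerts-⁅⁆ e v∈ with ∈subVerts⁻ v∈
  ... | i , i∈e , v∈i = InHE⇒∈ (subst (λ j → InHE H j _) (x∈⁅y⁆⇒x≡y _ i∈e) v∈i)

  HWalk-++ : ∀ {S u v w} → HWalk H S u v → HWalk H S v w → HWalk H S u w
  HWalk-++ p here = p
  HWalk-++ p (step i i∈S v∈i w∈i q) = step i i∈S v∈i w∈i (HWalk-++ p q)

  HWalk-edge : ∀ {S u v} i → i ∈ S → InHE H i u → InHE H i v → HWalk H S u v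
  HWalk-edge i i∈S u∈i v∈i = step i i∈S u∈i v∈i here

  HWalk-reverse : ∀ {S u v} → HWalk H S u v → HWalk H S v u
  HWalk-reverse here = here
  HWalk-reverse (step i i∈S v∈i w∈i q) = HWalk-++ (HWalk-edge i i∈S w∈i v∈i) (HWalk-reverse q)

  HWalk-mono : ∀ {S S' u v} → S ⊆ S' → HWalk H S u v → HWalk H S' u v
  HWalk-mono S⊆S' here = here
  HWalk-mono S⊆S' (step i i∈S v∈i w∈i q) = step i (S⊆S' i∈S) v∈i w∈i (HWalk-mono S⊆S' q)

  Rooted : Subset m → Fin n → Set
  Rooted S z = ∀ v → v ∈ subVerts H S → HWalk H S z v

  rooted⇒connected : ∀ {S z} → Rooted S z → HConnected H S
  rooted⇒connected rooted u v u∈ v∈ = HWalk-++ (HWalk-reverse (rooted u u∈)) (rooted v v∈)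

  rooted-⁅⁆ : ∀ {e z} → InHE H e z → Rooted ⁅ e ⁆ z
  rooted-⁅⁆ z∈e v v∈ with ∈subVerts⁻ v∈
  ... | i , i∈ , v∈i = HWalk-edge i i∈ (subst (λ j → InHE H j _) (sym (x∈⁅y⁆⇒x≡y _ i∈)) z∈e) v∈i

  rooted-∪⁅⁆ : ∀ {T z e c} → Rooted T z → c ∈ subVerts H T → InHE H e c → Rooted (T ∪ ⁅ e ⁆) z
  rooted-∪⁅⁆ {T} {e = e} rooted c∈T c∈e v v∈ with ∈subVerts⁻ v∈
  ... | i , i∈ , v∈i with x∈p∪q⁻ T ⁅ e ⁆ i∈
  ... | inj₁ i∈T = HWalk-mono (p⊆p∪q ⁅ e ⁆) (rooted v (∈subVerts⁺ i∈T v∈i))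
  ... | inj₂ i∈e = HWalk-++ (HWalk-mono (p⊆p∪q ⁅ e ⁆) (rooted _ c∈T))
                            (HWalk-edge i i∈ (subst (λ j → InHE H j _) (sym (x∈⁅y⁆⇒x≡y _ i∈e)) c∈e) v∈i)

  NullityAtLeast : Subset m → ℕ → Set
  NullityAtLeast T ν = ν + ∣ subVerts H T ∣ ≤ (r ∸ 1) * ∣ T ∣ + 1

  nullity-⁅⁆ : ∀ e → NullityAtLeast ⁅ e ⁆ 0
  nullity-⁅⁆ e = begin
    ∣ subVerts H ⁅ e ⁆ ∣         ≤⟨ p⊆q⇒∣p∣≤∣q∣ (subVerts-⁅⁆ e) ⟩
    ∣ vertexSet e ∣              ≡⟨ ∣vertexSet∣≡r e ⟩
    r                            ≤⟨ m≤m∸1+1 r ⟩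
    (r ∸ 1) + 1                  ≡⟨ cong (λ y → y + 1) (*-identityʳ (r ∸ 1)) ⟨
    (r ∸ 1) * 1 + 1              ≡⟨ cong (λ y → (r ∸ 1) * y + 1) (∣⁅x⁆∣≡1 e) ⟨
    (r ∸ 1) * ∣ ⁅ e ⁆ ∣ + 1      ∎
    where
    open ≤-Reasoning
    m≤m∸1+1 : ∀ x → x ≤ (x ∸ 1) + 1
    m≤m∸1+1 zero = z≤n
    m≤m∸1+1 (suc x) = ≤-reflexive (+-comm 1 x)

  -- A hyperedge sharing t + 1 vertices with T adds r − 1 to (r − 1)·e but at most r − t − 1 vertices.
  nullity-∪⁅⁆ : ∀ {T ν} e t → e ∉ T → NullityAtLeast T ν → suc t ≤ ∣ vertexSet e ∩ subVerts H T ∣ →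
                NullityAtLeast (T ∪ ⁅ e ⁆) (ν + t)
  nullity-∪⁅⁆ {T} {ν} e t e∉T nullity t<shared =
    subst (λ y → ν + t + ∣ subVerts H (T ∪ ⁅ e ⁆) ∣ ≤ (r ∸ 1) * y + 1) (sym (∣p∪⁅x⁆∣≡1+∣p∣ T e e∉T))
      (nullity-step r 0<r vertex-count t<shared nullity)
    where
    A = subVerts H T
    B = vertexSet e
    0<r : 0 < r
    0<r = ≤-trans (s≤s z≤n) (≤-trans t<shared (≤-trans (∣p∩q∣≤∣p∣ B A) (≤-reflexive (∣vertexSet∣≡r e))))
    vertex-count : ∣ subVerts H (T ∪ ⁅ e ⁆) ∣ + ∣ B ∩ A ∣ ≤ ∣ A ∣ + r
    vertex-count = begin
      ∣ subVerts H (T ∪ ⁅ e ⁆) ∣ + ∣ B ∩ A ∣  ≤⟨ +-monoˡ-≤ _ (p⊆q⇒∣p∣≤∣q∣ (subVerts-∪⁅⁆ T e)) ⟩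
      ∣ A ∪ B ∣ + ∣ B ∩ A ∣                   ≡⟨ cong (λ y → ∣ A ∪ B ∣ + ∣ y ∣) (∩-comm B A) ⟩
      ∣ A ∪ B ∣ + ∣ A ∩ B ∣                   ≡⟨ ∣p∪q∣+∣p∩q∣≡∣p∣+∣q∣ A B ⟩
      ∣ A ∣ + ∣ B ∣                           ≡⟨ cong (∣ A ∣ +_) (∣vertexSet∣≡r e) ⟩
      ∣ A ∣ + r                               ∎
      where open ≤-Reasoning

  avoidable : ∀ {T z} → 2 < r → Rooted T z → NullityAtLeast T 2 → ∣ T ∣ ≤ suc r → HasAvoidable H
  avoidable 2<r rooted nullity ∣T∣≤1+r =
    _ , (rooted⇒connected rooted , nullity) , ≤-trans ∣T∣≤1+r (suc-r≤2*rC2 2<r)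

next : ∀ {k} → Fin (suc k) → Fin (suc k)
next {k} i with toℕ i <? k
... | yes i<k = fromℕ< (s≤s i<k)
... | no _ = fz

toℕ-next : ∀ {k} (i : Fin (suc k)) → toℕ i < k → toℕ (next i) ≡ suc (toℕ i)
toℕ-next {k} i i<k with toℕ i <? k
... | yes i<k = toℕ-fromℕ< (s≤s i<k)
... | no i≮k = ⊥-elim (i≮k i<k)

next-last : ∀ {k} (i : Fin (suc k)) → ¬ toℕ i < k → next i ≡ fz
next-last {k} i i≮k with toℕ i <? k
... | yes i<k = ⊥-elim (i≮k i<k)
... | no _ = refl

toℕ-last : ∀ {k} (i : Fin (suc k)) → ¬ toℕ i < k → toℕ i ≡ k
toℕ-last i i≮k = ≤-antisym (≤-pred (toℕ<n i)) (≮⇒≥ i≮k)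

next-injective : ∀ {k} → Injective _≡_ _≡_ (next {k})
next-injective {k} {i} {j} eq = by-cases (toℕ i <? k) (toℕ j <? k)
  where
  by-cases : Dec (toℕ i < k) → Dec (toℕ j < k) → i ≡ j
  by-cases (yes i<k) (yes j<k) =
    toℕ-injective (ℕ.suc-injective (trans (sym (toℕ-next i i<k)) (trans (cong toℕ eq) (toℕ-next j j<k))))
  by-cases (yes i<k) (no j≮k) with trans (sym (toℕ-next i i<k)) (trans (cong toℕ eq) (cong toℕ (next-last j j≮k)))
  ... | ()
  by-cases (no i≮k) (yes j<k) with trans (sym (toℕ-next j j<k)) (trans (cong toℕ (sym eq)) (cong toℕ (next-last i i≮k)))
  ... | ()
  by-cases (no i≮k) (no j≮k) = toℕ-injective (trans (toℕ-last i i≮k) (sym (toℕ-last j j≮k)))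

next-≢ : ∀ {k} (i : Fin (suc (suc k))) → next i ≢ i
next-≢ {k} i next≡i = by-cases (toℕ i <? suc k)
  where
  by-cases : Dec (toℕ i < suc k) → ⊥
  by-cases (yes i<k) = <-irrefl (trans (sym (cong toℕ next≡i)) (toℕ-next i i<k)) (n<1+n (toℕ i))
  by-cases (no i≮k) with trans (sym (toℕ-last i i≮k)) (trans (cong toℕ (sym next≡i)) (cong toℕ (next-last i i≮k)))
  ... | ()

previous : ∀ {k} (i : Fin (suc k)) → ∃ λ j → next j ≡ i
previous {k} fz = fromℕ k , next-last (fromℕ k) (λ k<k → <-irrefl (toℕ-fromℕ k) k<k)
previous {k} (fs i) = inject₁ i , toℕ-injective (trans (toℕ-next (inject₁ i) i<k) (cong suc (toℕ-inject₁ i)))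
  where
  i<k : toℕ (inject₁ i) < k
  i<k = ≤-trans (s≤s (≤-reflexive (toℕ-inject₁ i))) (toℕ<n i)

module _ {r n m} {F : Graph r} (H : FGraph F n m) where

  CycSucc⇒≡next : ∀ {k} {i j : Fin (suc k)} → CycSucc H j i → i ≡ next j
  CycSucc⇒≡next {k} {i} {j} (inj₁ i≡1+j) = by-cases (toℕ j <? k)
    where
    by-cases : Dec (toℕ j < k) → i ≡ next j
    by-cases (yes j<k) = toℕ-injective (trans i≡1+j (sym (toℕ-next j j<k)))
    by-cases (no j≮k) = ⊥-elim (<-irrefl (trans i≡1+j (cong suc (toℕ-last j j≮k))) (toℕ<n i))
  CycSucc⇒≡next {k} {i} {j} (inj₂ (1+j≡1+k , i≡0)) =
    trans (toℕ-injective {i = i} {j = fz} i≡0) (sym (next-last j λ j<k → <-irrefl (ℕ.suc-injective 1+j≡1+k) j<k))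

  ≡next⇒CycSucc : ∀ {k} {i j : Fin (suc k)} → i ≡ next j → CycSucc H j i
  ≡next⇒CycSucc {k} {j = j} refl = by-cases (toℕ j <? k)
    where
    by-cases : Dec (toℕ j < k) → CycSucc H j (next j)
    by-cases (yes j<k) = inj₁ (toℕ-next j j<k)
    by-cases (no j≮k) = inj₂ (cong suc (toℕ-last j j≮k) , cong toℕ (next-last j j≮k))

-- Growing a connected sub-hypergraph of nullity one until it covers F₀

module Covering {r n m} {F : Graph r} (k2 : KConnected 2 F) (H : FGraph F n m) (F₀ : Copy F n)
                (F₀⊆G : CopyInG H F₀) where

  open Hypergraph H public

  ψ : Fin r → Fin n
  ψ = emb F₀

  ψ-inj : Injective _≡_ _≡_ ψ
  ψ-inj = embInj F₀

  2<r : 2 < r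
  2<r = proj₁ k2

  edge-of-F₀ : ∀ {a b} → adj F a b ≡ true → ∃ λ i → EdgeOfCopy (fedge H i) (ψ a) (ψ b)
  edge-of-F₀ {a} {b} ab = proj₂ F₀⊆G (ψ a) (ψ b) (a , b , refl , refl , ab)

  EdgeOfCopy⇒∈ : ∀ {i u v} → EdgeOfCopy (fedge H i) u v → u ∈ vertexSet i × v ∈ vertexSet i
  EdgeOfCopy⇒∈ (a , b , φa≡u , φb≡v , _) = InHE⇒∈ (a , φa≡u) , InHE⇒∈ (b , φb≡v)

  edge-in-hyperedge : ∀ {a b} → adj F a b ≡ true → ∃ λ i → ψ a ∈ vertexSet i × ψ b ∈ vertexSet i
  edge-in-hyperedge ab with edge-of-F₀ ab
  ... | i , ab∈i = i , EdgeOfCopy⇒∈ ab∈i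

  CoveredBy : Subset m → Fin r → Fin r → Set
  CoveredBy T a b = ∃ λ j → j ∈ T × ψ a ∈ vertexSet j × ψ b ∈ vertexSet j

  coveredBy? : ∀ T a b → Dec (CoveredBy T a b)
  coveredBy? T a b = any? (λ j → (j ∈? T) ×-dec ((ψ a ∈? vertexSet j) ×-dec (ψ b ∈? vertexSet j)))

  Covered : Subset m → Set
  Covered T = ∀ a b → adj F a b ≡ true → CoveredBy T a b

  coveredVertices : Subset m → Subset r
  coveredVertices T = tabulate λ a → does (ψ a ∈? subVerts H T)

  ∈coveredVertices⁺ : ∀ {T a} → ψ a ∈ subVerts H T → a ∈ coveredVertices T
  ∈coveredVertices⁺ {T} {a} ψa∈ = ∈-tabulate⁺ (dec-true (ψ a ∈? subVerts H T) ψa∈)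

  ∈coveredVertices⁻ : ∀ {T a} → a ∈ coveredVertices T → ψ a ∈ subVerts H T
  ∈coveredVertices⁻ {T} {a} a∈ = dec-true⁻ (ψ a ∈? subVerts H T) (∈-tabulate⁻ a∈)

  fibre : (c : Fin n) → ∃ λ X → ∣ X ∣ < 2 × (∀ t → t ∈ X → ψ t ≡ c) × (∀ t → ψ t ≡ c → t ∈ X)
  fibre c with any? (λ a → ψ a ≟ c)
  ... | yes (a , ψa≡c) =
    ⁅ a ⁆ , s≤s (≤-reflexive (∣⁅x⁆∣≡1 a)) , (λ t t∈ → trans (cong ψ (x∈⁅y⁆⇒x≡y _ t∈)) ψa≡c) ,
    (λ t ψt≡c → subst (_∈ ⁅ a ⁆) (ψ-inj (trans ψa≡c (sym ψt≡c))) (x∈⁅x⁆ a))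
  ... | no none =
    ∅ , subst (_< 2) (sym (∣⊥∣≡0 r)) (s≤s z≤n) , (λ t t∈ → ⊥-elim (∉⊥ t∈)) , (λ t ψt≡c → ⊥-elim (none (t , ψt≡c)))

  module Growth (o₁ o₂ : Fin r) (o₁≢o₂ : o₁ ≢ o₂) where

    record Invariant (T : Subset m) : Set where
      field
        rooted      : Rooted T (ψ o₁)
        nullity     : NullityAtLeast T 1
        o₁∈         : ψ o₁ ∈ subVerts H T
        o₂∈         : ψ o₂ ∈ subVerts H T
        ∣T∣≤covered : ∣ T ∣ ≤ ∣ coveredVertices T ∣
    open Invariant

    -- If e met T in the single vertex c, then F₀ − ψ⁻¹(c), which is connected, would be split
    -- between the vertices in e outside T and those in T.
    pendant-impossible : ∀ {T e c w} → Invariant T → c ∈ subVerts H T →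
                         (∀ v → v ∈ vertexSet e → v ∈ subVerts H T → v ≡ c) →
                         ψ w ∈ vertexSet e → ψ w ∉ subVerts H T → Covered (T ∪ ⁅ e ⁆) → ⊥
    pendant-impossible {T} {e} {c} {w} inv c∈T meets-only-c ψw∈e ψw∉T covered =
      ψo≢c (meets-only-c (ψ o) (proj₁ (stays-in-e walk)) ψo∈T)
      where
      X = proj₁ (fibre c)
      ∣X∣<2 = proj₁ (proj₂ (fibre c))
      X⇒c = proj₁ (proj₂ (proj₂ (fibre c)))
      c⇒X = proj₂ (proj₂ (proj₂ (fibre c)))
      other-root : ∃ λ o → ψ o ∈ subVerts H T × ψ o ≢ c
      other-root with ψ o₁ ≟ c
      ... | no ψo₁≢c = o₁ , o₁∈ inv , ψo₁≢c
      ... | yes ψo₁≡c = o₂ , o₂∈ inv , λ ψo₂≡c → o₁≢o₂ (ψ-inj (trans ψo₁≡c (sym ψo₂≡c)))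
      o = proj₁ other-root
      ψo∈T = proj₁ (proj₂ other-root)
      ψo≢c = proj₂ (proj₂ other-root)
      walk : Walk F X w o
      walk = proj₂ k2 X ∣X∣<2 w o (λ w∈X → ψw∉T (subst (_∈ subVerts H T) (sym (X⇒c w w∈X)) c∈T))
                                   (λ o∈X → ψo≢c (X⇒c o o∈X))
      stays-in-e : ∀ {t} → Walk F X w t → ψ t ∈ vertexSet e × ψ t ∉ subVerts H T
      stays-in-e here = ψw∈e , ψw∉T
      stays-in-e (step {v} {t} walk vt t∉X) with stays-in-e walk | covered v t vt
      ... | ψv∈e , ψv∉T | j , j∈ , ψv∈j , ψt∈j with x∈p∪q⁻ T ⁅ e ⁆ j∈
      ... | inj₁ j∈T = ⊥-elim (ψv∉T (∈subVerts⁺ j∈T (∈⇒InHE ψv∈j)))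
      ... | inj₂ j∈e = ψt∈e , λ ψt∈T → t∉X (c⇒X t (meets-only-c _ ψt∈e ψt∈T))
        where ψt∈e = subst (λ i → ψ t ∈ vertexSet i) (x∈⁅y⁆⇒x≡y _ j∈e) ψt∈j

    module Extend {T : Subset m} (inv : Invariant T) {a b} (ab : adj F a b ≡ true) (ψa∈T : ψ a ∈ subVerts H T)
                  (e∉T : proj₁ (edge-in-hyperedge ab) ∉ T) where
      e : Fin m
      e = proj₁ (edge-in-hyperedge ab)

      ψa∈e : ψ a ∈ vertexSet e
      ψa∈e = proj₁ (proj₂ (edge-in-hyperedge ab))

      ψb∈e : ψ b ∈ vertexSet e
      ψb∈e = proj₂ (proj₂ (edge-in-hyperedge ab))

      T' : Subset m
      T' = T ∪ ⁅ e ⁆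

      T⊆T' : T ⊆ T'
      T⊆T' = p⊆p∪q ⁅ e ⁆

      rooted' : Rooted T' (ψ o₁)
      rooted' = rooted-∪⁅⁆ (rooted inv) ψa∈T (∈⇒InHE ψa∈e)

      two-shared⇒avoidable : 2 ≤ ∣ vertexSet e ∩ subVerts H T ∣ → HasAvoidable H
      two-shared⇒avoidable 2≤shared = avoidable 2<r rooted' (nullity-∪⁅⁆ e 1 e∉T (nullity inv) 2≤shared)
        (≤-trans (≤-reflexive (∣p∪⁅x⁆∣≡1+∣p∣ T e e∉T))
                 (s≤s (≤-trans (∣T∣≤covered inv) (∣p∣≤n (coveredVertices T)))))

      more-covered : ψ b ∉ subVerts H T → ∣ coveredVertices T ∣ < ∣ coveredVertices T' ∣
      more-covered ψb∉T = ≤-trans (≤-reflexive (sym (∣p∪⁅x⁆∣≡1+∣p∣ (coveredVertices T) b (ψb∉T ∘ ∈coveredVertices⁻))))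
        (p⊆q⇒∣p∣≤∣q∣ λ x∈ → [ (λ x∈T → ∈coveredVertices⁺ (subVerts-mono T⊆T' (∈coveredVertices⁻ x∈T)))
                             , (λ x∈b → ∈coveredVertices⁺ (subst (λ y → ψ y ∈ subVerts H T') (sym (x∈⁅y⁆⇒x≡y _ x∈b))
                                                                  (∈subVerts⁺ (x∈p∪q⁺ (inj₂ (x∈⁅x⁆ e))) (∈⇒InHE ψb∈e)))) ]′
                             (x∈p∪q⁻ _ _ x∈))

      invariant' : ψ b ∉ subVerts H T → Invariant T'
      invariant' ψb∉T = record
        { rooted = rooted'
        ; nullity = subst (NullityAtLeast T') (+-identityʳ 1)
                      (nullity-∪⁅⁆ e 0 e∉T (nullity inv) (x∈p⇒0<∣p∣ (x∈p∩q⁺ (ψa∈e , ψa∈T))))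
        ; o₁∈ = subVerts-mono T⊆T' (o₁∈ inv)
        ; o₂∈ = subVerts-mono T⊆T' (o₂∈ inv)
        ; ∣T∣≤covered = ≤-trans (≤-reflexive (∣p∪⁅x⁆∣≡1+∣p∣ T e e∉T))
                                (≤-trans (s≤s (∣T∣≤covered inv)) (more-covered ψb∉T)) }

    crossing-edge⇒avoidable :
      ∀ {T a b} → Invariant T → (ab : adj F a b ≡ true) → ψ a ∈ subVerts H T → ψ b ∉ subVerts H T →
      (∀ T' → Invariant T' → ∣ coveredVertices T ∣ < ∣ coveredVertices T' ∣ → HasAvoidable H ⊎ Covered T') →
      HasAvoidable H
    crossing-edge⇒avoidable {T} {a} {b} inv ab ψa∈T ψb∉T grow-further =
      by-cases (2 ≤? ∣ vertexSet e ∩ subVerts H T ∣)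
      where
      open Extend inv ab ψa∈T (λ e∈T → ψb∉T (∈subVerts⁺ e∈T (∈⇒InHE (proj₂ (proj₂ (edge-in-hyperedge ab))))))
      meets-only-ψa : ¬ 2 ≤ ∣ vertexSet e ∩ subVerts H T ∣ → ∀ v → v ∈ vertexSet e → v ∈ subVerts H T → v ≡ ψ a
      meets-only-ψa 2≰shared v v∈e v∈T = decidable-stable (v ≟ ψ a) λ v≢ψa →
        2≰shared (two-elements⇒2≤∣p∣ (x∈p∩q⁺ (v∈e , v∈T)) (x∈p∩q⁺ (ψa∈e , ψa∈T)) v≢ψa)
      by-cases : Dec (2 ≤ ∣ vertexSet e ∩ subVerts H T ∣) → HasAvoidable H
      by-cases (yes 2≤shared) = two-shared⇒avoidable 2≤shared
      by-cases (no 2≰shared) =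
        [ id , (λ covered → ⊥-elim (pendant-impossible inv ψa∈T (meets-only-ψa 2≰shared) ψb∈e ψb∉T covered)) ]′
          (grow-further T' (invariant' ψb∉T) (more-covered ψb∉T))

    -- F₀ then lies inside T, so the hyperedge carrying an uncovered edge meets T twice.
    uncovered-edge⇒avoidable :
      ∀ {T a b} → Invariant T → (∀ u w → adj F u w ≡ true → ψ u ∈ subVerts H T → ψ w ∈ subVerts H T) →
      (ab : adj F a b ≡ true) → ¬ CoveredBy T a b → HasAvoidable H
    uncovered-edge⇒avoidable {T} {a} {b} inv closed ab ¬covered =
      two-shared⇒avoidable (two-elements⇒2≤∣p∣ (x∈p∩q⁺ (ψa∈e , all-in a)) (x∈p∩q⁺ (ψb∈e , all-in b))
                                              (λ ψa≡ψb → adjacent⇒≢ {F = F} ab (ψ-inj ψa≡ψb)))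
      where
      all-in : ∀ x → ψ x ∈ subVerts H T
      all-in x = walk-preserves (λ y → ψ y ∈ subVerts H T) (λ {u} {w} uw _ → closed u w uw) (connected k2 o₁ x) (o₁∈ inv)
      ψa∈e′ = proj₁ (proj₂ (edge-in-hyperedge ab))
      ψb∈e′ = proj₂ (proj₂ (edge-in-hyperedge ab))
      open Extend inv ab (all-in a) (λ e∈T → ¬covered (_ , e∈T , ψa∈e′ , ψb∈e′))

    grow : (fuel : ℕ) (T : Subset m) → Invariant T → r ≤ ∣ coveredVertices T ∣ + fuel →
           HasAvoidable H ⊎ Covered T
    grow fuel T inv enough
      with any? (λ a → any? (λ b → (adj F a b ≟ᵇ true) ×-dec ((ψ a ∈? subVerts H T) ×-dec ¬? (ψ b ∈? subVerts H T))))
    ... | yes (a , b , ab , ψa∈T , ψb∉T) = inj₁ (crossing-edge⇒avoidable inv ab ψa∈T ψb∉T (grow-further fuel enough))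
      where
      grow-further : ∀ fuel → r ≤ ∣ coveredVertices T ∣ + fuel →
                     ∀ T' → Invariant T' → ∣ coveredVertices T ∣ < ∣ coveredVertices T' ∣ → HasAvoidable H ⊎ Covered T'
      grow-further zero enough T' _ more =
        ⊥-elim (<-irrefl refl (≤-trans more (≤-trans (∣p∣≤n (coveredVertices T'))
                                                      (≤-trans enough (≤-reflexive (+-identityʳ _))))))
      grow-further (suc fuel) enough T' inv' more =
        grow fuel T' inv' (≤-trans enough (≤-trans (≤-reflexive (+-suc _ fuel)) (+-monoˡ-≤ fuel more)))
    ... | no no-crossing with any? (λ a → any? (λ b → (adj F a b ≟ᵇ true) ×-dec ¬? (coveredBy? T a b)))
    ... | no all-covered = inj₂ λ a b ab → decidable-stable (coveredBy? T a b) λ ¬cov → all-covered (a , b , ab , ¬cov)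
    ... | yes (a , b , ab , ¬covered) = inj₁ (uncovered-edge⇒avoidable inv closed ab ¬covered)
      where
      closed : ∀ u w → adj F u w ≡ true → ψ u ∈ subVerts H T → ψ w ∈ subVerts H T
      closed u w uw ψu∈T = decidable-stable (ψ w ∈? subVerts H T) λ ψw∉T → no-crossing (u , w , uw , ψu∈T , ψw∉T)

-- Cycles of hyperedges through vertices of F₀

  record CycleCandidate : Set where
    field
      K        : ℕ
      h        : Fin (2 + K) → Fin m
      h-inj    : Injective _≡_ _≡_ h
      x        : Fin (2 + K) → Fin r
      x-inj    : Injective _≡_ _≡_ x
      x∈h      : ∀ i → ψ (x i) ∈ vertexSet (h i)
      next-x∈h : ∀ i → ψ (x (next i)) ∈ vertexSet (h i)

  module Candidate (c : CycleCandidate) where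
    open CycleCandidate c public

    k : ℕ
    k = 2 + K

    𝒞 : Subset m
    𝒞 = image h

    ∣𝒞∣≡k : ∣ 𝒞 ∣ ≡ k
    ∣𝒞∣≡k = ∣image∣≡ h h-inj

    X : Subset n
    X = image (ψ ∘ x)

    ψx-inj : Injective _≡_ _≡_ (ψ ∘ x)
    ψx-inj e = x-inj (ψ-inj e)

    -- The vertex set of the cycle is X plus the parts of the h j outside X, and each h j meets X in
    -- at least two vertices; so it has at most k (r − 1) vertices, with strict inequality as soon as
    -- some h j meets X a third time or two of the parts outside X overlap.
    private-part : Fin k → Subset n
    private-part j = vertexSet (h j) ─ X

    Σprivate : ℕ
    Σprivate = sumFin (λ j → ∣ private-part j ∣)

    ∣private-part∣+∣h∩X∣≡r : ∀ j → ∣ private-part j ∣ + ∣ vertexSet (h j) ∩ X ∣ ≡ r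
    ∣private-part∣+∣h∩X∣≡r j = trans (∣p─q∣+∣p∩q∣≡∣p∣ (vertexSet (h j)) X) (∣vertexSet∣≡r (h j))

    2≤∣h∩X∣ : ∀ j → 2 ≤ ∣ vertexSet (h j) ∩ X ∣
    2≤∣h∩X∣ j = two-elements⇒2≤∣p∣ (x∈p∩q⁺ (x∈h j , ∈-image⁺ (ψ ∘ x) j)) (x∈p∩q⁺ (next-x∈h j , ∈-image⁺ (ψ ∘ x) (next j)))
                                   (λ e → next-≢ j (sym (ψx-inj e)))

    ∣private-part∣+2≤r : ∀ j → ∣ private-part j ∣ + 2 ≤ r
    ∣private-part∣+2≤r j = ≤-trans (+-monoʳ-≤ _ (2≤∣h∩X∣ j)) (≤-reflexive (∣private-part∣+∣h∩X∣≡r j))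

    subVerts-𝒞⊆ : subVerts H 𝒞 ⊆ X ∪ ⋃ private-part
    subVerts-𝒞⊆ v∈ with ∈subVerts⁻ v∈
    ... | _ , i∈𝒞 , v∈i with ∈-image⁻ h i∈𝒞
    ... | j , refl with _ ∈? X
    ... | yes v∈X = x∈p∪q⁺ (inj₁ v∈X)
    ... | no v∉X = x∈p∪q⁺ (inj₂ (∈-⋃⁺ private-part j (x∈p∧x∉q⇒x∈p─q (InHE⇒∈ v∈i) v∉X)))

    ∣subVerts-𝒞∣≤k+∣⋃∣ : ∣ subVerts H 𝒞 ∣ ≤ k + ∣ ⋃ private-part ∣
    ∣subVerts-𝒞∣≤k+∣⋃∣ = ≤-trans (p⊆q⇒∣p∣≤∣q∣ subVerts-𝒞⊆)
      (≤-trans (∣p∪q∣≤∣p∣+∣q∣ X _) (≤-reflexive (cong (_+ ∣ ⋃ private-part ∣) (∣image∣≡ (ψ ∘ x) ψx-inj))))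

    Σprivate+2k≤kr : Σprivate + k * 2 ≤ k * r
    Σprivate+2k≤kr = begin
      Σprivate + k * 2                      ≡⟨ sumFin-+-const (λ j → ∣ private-part j ∣) 2 ⟨
      sumFin (λ j → ∣ private-part j ∣ + 2)  ≤⟨ sumFin-mono ∣private-part∣+2≤r ⟩
      sumFin {k} (λ _ → r)                   ≡⟨ sumFin-const k r ⟩
      k * r                                  ∎
      where open ≤-Reasoning

    vertex-count : ∀ t → t + ∣ ⋃ private-part ∣ ≤ Σprivate → t + ∣ subVerts H 𝒞 ∣ + k ≤ Σprivate + k * 2
    vertex-count t t+∣⋃∣≤Σ = begin
      t + ∣ subVerts H 𝒞 ∣ + k                ≤⟨ +-monoˡ-≤ k (+-monoʳ-≤ t ∣subVerts-𝒞∣≤k+∣⋃∣) ⟩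
      t + (k + ∣ ⋃ private-part ∣) + k        ≡⟨ rearrange t ∣ ⋃ private-part ∣ k ⟩
      t + ∣ ⋃ private-part ∣ + k * 2          ≤⟨ +-monoˡ-≤ (k * 2) t+∣⋃∣≤Σ ⟩
      Σprivate + k * 2                        ∎
      where
      open ≤-Reasoning
      rearrange : ∀ a b k → a + (k + b) + k ≡ a + b + k * 2
      rearrange = solve 3 (λ a b k → a :+ (k :+ b) :+ k := a :+ b :+ k :* con 2) refl

    nullity-from-count : ∀ ν → ν + ∣ subVerts H 𝒞 ∣ + k ≤ k * r → NullityAtLeast 𝒞 (suc ν)
    nullity-from-count ν count = ≤-trans (≤-reflexive (+-comm 1 (ν + ∣ subVerts H 𝒞 ∣)))
      (+-monoˡ-≤ 1 (≤-trans (x+k≤k*R⇒x≤[R∸1]*k _ k r count) (≤-reflexive (cong ((r ∸ 1) *_) (sym ∣𝒞∣≡k)))))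

    nullity-one : NullityAtLeast 𝒞 1
    nullity-one = nullity-from-count 0 (≤-trans (vertex-count 0 (∣⋃∣≤sum private-part)) Σprivate+2k≤kr)

    third-vertex⇒nullity-two : ∀ i j → ψ (x i) ∈ vertexSet (h j) → i ≢ j → i ≢ next j → NullityAtLeast 𝒞 2
    third-vertex⇒nullity-two i j ψxi∈hj i≢j i≢next-j = nullity-from-count 1 (begin
      1 + ∣ subVerts H 𝒞 ∣ + k ≡⟨⟩
      suc (0 + ∣ subVerts H 𝒞 ∣ + k) ≤⟨ s≤s (vertex-count 0 (∣⋃∣≤sum private-part)) ⟩
      suc (Σprivate + k * 2)          ≡⟨ cong suc (sumFin-+-const (λ j → ∣ private-part j ∣) 2) ⟨
      suc (sumFin (λ j → ∣ private-part j ∣ + 2)) ≤⟨ sumFin-mono-< ∣private-part∣+2≤r j 2<r-private ⟩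
      sumFin {k} (λ _ → r)            ≡⟨ sumFin-const k r ⟩
      k * r                           ∎)
      where
      open ≤-Reasoning
      3≤∣h∩X∣ : 3 ≤ ∣ vertexSet (h j) ∩ X ∣
      3≤∣h∩X∣ = three-elements⇒3≤∣p∣ (x∈p∩q⁺ (x∈h j , ∈-image⁺ (ψ ∘ x) j)) (x∈p∩q⁺ (next-x∈h j , ∈-image⁺ (ψ ∘ x) (next j)))
                  (x∈p∩q⁺ (ψxi∈hj , ∈-image⁺ (ψ ∘ x) i))
                  (λ e → next-≢ j (sym (ψx-inj e))) (λ e → i≢j (sym (ψx-inj e))) (λ e → i≢next-j (sym (ψx-inj e)))
      2<r-private : ∣ private-part j ∣ + 2 < r
      2<r-private = ≤-trans (≤-reflexive (sym (+-suc _ 2)))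
                            (≤-trans (+-monoʳ-≤ _ 3≤∣h∩X∣) (≤-reflexive (∣private-part∣+∣h∩X∣≡r j)))

    shared-private-vertex⇒nullity-two : ∀ j l v → j ≢ l → v ∈ vertexSet (h j) → v ∈ vertexSet (h l) → v ∉ X →
                                        NullityAtLeast 𝒞 2
    shared-private-vertex⇒nullity-two j l v j≢l v∈j v∈l v∉X = nullity-from-count 1
      (≤-trans (vertex-count 1 (overlap⇒∣⋃∣<sum private-part j l j≢l (x∈p∧x∉q⇒x∈p─q v∈j v∉X) (x∈p∧x∉q⇒x∈p─q v∈l v∉X)))
               Σprivate+2k≤kr)

    reach : ∀ t (t<k : t < k) → HWalk H 𝒞 (ψ (x fz)) (ψ (x (fromℕ< t<k)))
    reach zero t<k = here
    reach (suc t) 1+t<k = step (h i) (∈-image⁺ h i) (∈⇒InHE (x∈h i))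
      (∈⇒InHE (subst (λ y → ψ (x y) ∈ vertexSet (h i)) next-i≡ (next-x∈h i))) (reach t t<k)
      where
      t<k : t < k
      t<k = ≤-trans (n≤1+n (suc t)) 1+t<k
      i = fromℕ< t<k
      next-i≡ : next i ≡ fromℕ< 1+t<k
      next-i≡ = toℕ-injective (trans (toℕ-next i (≤-trans (≤-reflexive (cong suc (toℕ-fromℕ< t<k))) (≤-pred 1+t<k)))
                                           (trans (cong suc (toℕ-fromℕ< t<k)) (sym (toℕ-fromℕ< 1+t<k))))

    rooted-𝒞 : Rooted 𝒞 (ψ (x fz))
    rooted-𝒞 v v∈ with ∈subVerts⁻ v∈
    ... | _ , i∈𝒞 , v∈i with ∈-image⁻ h i∈𝒞
    ... | j , refl =
      HWalk-++ (subst (λ i → HWalk H 𝒞 (ψ (x fz)) (ψ (x i))) (fromℕ<-toℕ j (toℕ<n j)) (reach (toℕ j) (toℕ<n j)))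
                              (HWalk-edge (h j) i∈𝒞 (∈⇒InHE (x∈h j)) v∈i)

    module G = Growth (x fz) (x (fs fz)) (λ e → 0≢1+n (cong toℕ (x-inj e)))

    invariant : G.Invariant 𝒞
    invariant = record
      { rooted = rooted-𝒞 ; nullity = nullity-one
      ; o₁∈ = ∈subVerts⁺ (∈-image⁺ h fz) (∈⇒InHE (x∈h fz))
      ; o₂∈ = ∈subVerts⁺ (∈-image⁺ h (fs fz)) (∈⇒InHE (x∈h (fs fz)))
      ; ∣T∣≤covered = ≤-trans (≤-reflexive (trans ∣𝒞∣≡k (sym (∣image∣≡ x x-inj))))
                        (p⊆q⇒∣p∣≤∣q∣ λ a∈ → x-covered (∈-image⁻ x a∈)) }
      where
      x-covered : ∀ {a} → ∃ (λ i → x i ≡ a) → a ∈ coveredVertices 𝒞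
      x-covered (i , refl) = ∈coveredVertices⁺ (∈subVerts⁺ (∈-image⁺ h i) (∈⇒InHE (x∈h i)))

    nullity-two⇒avoidable : NullityAtLeast 𝒞 2 → HasAvoidable H
    nullity-two⇒avoidable nullity =
      avoidable 2<r rooted-𝒞 nullity (≤-trans (≤-reflexive ∣𝒞∣≡k) (≤-trans (injective⇒≤ x-inj) (n≤1+n r)))

    Clean : Set
    Clean = (∀ i j → ψ (x i) ∈ vertexSet (h j) → i ≡ j ⊎ i ≡ next j) ×
            (∀ j l v → j ≢ l → v ∈ vertexSet (h j) → v ∈ vertexSet (h l) → ∃ λ i → ψ (x i) ≡ v) ×
            Covered 𝒞

    avoidable-or-clean : HasAvoidable H ⊎ Clean
    avoidable-or-clean with any? (λ i → any? (λ j → (ψ (x i) ∈? vertexSet (h j)) ×-dec (¬? (i ≟ j) ×-dec ¬? (i ≟ next j))))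
    ... | yes (i , j , ψxi∈hj , i≢j , i≢next-j) =
      inj₁ (nullity-two⇒avoidable (third-vertex⇒nullity-two i j ψxi∈hj i≢j i≢next-j))
    ... | no no-third
      with any? (λ j → any? (λ l → any? (λ v → ¬? (j ≟ l) ×-dec ((v ∈? vertexSet (h j)) ×-dec
                                                                  ((v ∈? vertexSet (h l)) ×-dec ¬? (v ∈? X))))))
    ... | yes (j , l , v , j≢l , v∈j , v∈l , v∉X) =
      inj₁ (nullity-two⇒avoidable (shared-private-vertex⇒nullity-two j l v j≢l v∈j v∈l v∉X))
    ... | no no-shared with G.grow r 𝒞 invariant (m≤n+m r _)
    ... | inj₁ avoidable = inj₁ avoidable
    ... | inj₂ covered = inj₂ (only-consecutive , only-cycle-vertices-shared , covered)
      where
      only-consecutive : ∀ i j → ψ (x i) ∈ vertexSet (h j) → i ≡ j ⊎ i ≡ next j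
      only-consecutive i j ψxi∈hj with i ≟ j | i ≟ next j
      ... | yes i≡j | _ = inj₁ i≡j
      ... | no _ | yes i≡next-j = inj₂ i≡next-j
      ... | no i≢j | no i≢next-j = ⊥-elim (no-third (i , j , ψxi∈hj , i≢j , i≢next-j))
      only-cycle-vertices-shared : ∀ j l v → j ≢ l → v ∈ vertexSet (h j) → v ∈ vertexSet (h l) → ∃ λ i → ψ (x i) ≡ v
      only-cycle-vertices-shared j l v j≢l v∈j v∈l =
        ∈-image⁻ (ψ ∘ x) (decidable-stable (v ∈? X) λ v∉X → no-shared (j , l , v , j≢l , v∈j , v∈l , v∉X))

    clean⇒CleanCycleCovering : Clean → CleanCycleCovering H k F₀
    clean⇒CleanCycleCovering (only-consecutive , only-cycle-vertices-shared , covered) =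
      h , ψ ∘ x , h-inj , ψx-inj , membership , shared , covering
      where
      membership : ∀ i j → InHE H (h j) (ψ (x i)) ⇔ (i ≡ j ⊎ CycSucc H j i)
      membership i j = mk⇔
        (λ ψxi∈hj → Sum.map₂ (≡next⇒CycSucc H) (only-consecutive i j (InHE⇒∈ ψxi∈hj)))
        [ (λ { refl → ∈⇒InHE (x∈h i) })
        , (λ succ → subst (λ y → InHE H (h j) (ψ (x y))) (sym (CycSucc⇒≡next H succ)) (∈⇒InHE (next-x∈h j))) ]′
      shared : ∀ j l v → j ≢ l → InHE H (h j) v → InHE H (h l) v → ∃ λ i → ψ (x i) ≡ v
      shared j l v j≢l v∈j v∈l = only-cycle-vertices-shared j l v j≢l (InHE⇒∈ v∈j) (InHE⇒∈ v∈l)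
      covering : ∀ u v → EdgeOfCopy F₀ u v → ∃ λ j → InHE H (h j) u × InHE H (h j) v
      covering _ _ (a , b , refl , refl , ab) with covered a b ab
      ... | _ , i∈𝒞 , ψa∈i , ψb∈i with ∈-image⁻ h i∈𝒞
      ... | j , refl = j , ∈⇒InHE ψa∈i , ∈⇒InHE ψb∈i

  module Trails (e₀ : Fin m) (u : Fin r) (ψu∈e₀ : ψ u ∈ vertexSet e₀) where

    -- z (fromℕ l) = u is where the trail starts and z fz its current end.
    record Trail (l : ℕ) : Set where
      field
        z       : Fin (suc l) → Fin r
        z-inj   : Injective _≡_ _≡_ z
        g       : Fin l → Fin m
        g-inj   : Injective _≡_ _≡_ g
        z∈g     : ∀ i → ψ (z (inject₁ i)) ∈ vertexSet (g i)
        next-z∈g : ∀ i → ψ (z (fs i)) ∈ vertexSet (g i)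
        starts  : z (fromℕ l) ≡ u
        g≢e₀    : ∀ i → g i ≢ e₀
    open Trail

    drop-end : ∀ {l} → Trail (suc l) → Trail l
    drop-end p = record
      { z = λ i → z p (fs i) ; z-inj = λ e → suc-injective (z-inj p e)
      ; g = λ i → g p (fs i) ; g-inj = λ e → suc-injective (g-inj p e)
      ; z∈g = λ i → z∈g p (fs i) ; next-z∈g = λ i → next-z∈g p (fs i)
      ; starts = starts p ; g≢e₀ = λ i → g≢e₀ p (fs i) }

    cut-at-vertex : ∀ {l} (p : Trail l) d → ∃ (λ i → z p i ≡ d) → ∃ λ l' → Σ (Trail l') λ p' → z p' fz ≡ d
    cut-at-vertex p d _ with z p fz ≟ d
    cut-at-vertex p d _ | yes end≡d = _ , p , end≡d
    cut-at-vertex {zero} p d (fz , e) | no end≢d = ⊥-elim (end≢d e)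
    cut-at-vertex {suc l} p d (fz , e) | no end≢d = ⊥-elim (end≢d e)
    cut-at-vertex {suc l} p d (fs i , e) | no _ = cut-at-vertex (drop-end p) d (i , e)

    cut-at-hyperedge : ∀ {l} (p : Trail l) f → ∃ (λ i → g p i ≡ f) →
                       ∃ λ l' → Σ (Trail l') λ p' → ψ (z p' fz) ∈ vertexSet f × (∀ i → g p' i ≢ f) ×
                                                    (∀ i → ∃ λ j → z p' i ≡ z p j)
    cut-at-hyperedge {suc l} p f _ with g p fz ≟ f
    ... | yes g0≡f = l , drop-end p , subst (λ j → ψ (z p (fs fz)) ∈ vertexSet j) g0≡f (next-z∈g p fz) ,
                     (λ i g≡f → fs≢fz (g-inj p (trans g≡f (sym g0≡f)))) , (λ i → fs i , refl)
      where
      fs≢fz : ∀ {i : Fin l} → fs i ≢ fz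
      fs≢fz ()
    cut-at-hyperedge {suc l} p f (fz , e) | no g0≢f = ⊥-elim (g0≢f e)
    cut-at-hyperedge {suc l} p f (fs i , e) | no _ with cut-at-hyperedge (drop-end p) f (i , e)
    ... | l' , p' , end∈f , g'≢f , on-p = l' , p' , end∈f , g'≢f , λ i → let (j , z≡) = on-p i in fs j , z≡

    extend : ∀ {l} (p : Trail l) d f → ψ (z p fz) ∈ vertexSet f → ψ d ∈ vertexSet f →
             (∀ i → z p i ≢ d) → (∀ i → g p i ≢ f) → f ≢ e₀ → Trail (suc l)
    extend {l} p d f end∈f d∈f d-new f-new f≢e₀ = record
      { z = z' ; z-inj = z'-inj ; g = g' ; g-inj = g'-inj ; z∈g = z'∈g' ; next-z∈g = next-z'∈g'
      ; starts = starts p ; g≢e₀ = g'≢e₀ }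
      where
      z' : Fin (suc (suc l)) → Fin r
      z' fz = d
      z' (fs i) = z p i
      g' : Fin (suc l) → Fin m
      g' fz = f
      g' (fs i) = g p i
      z'-inj : Injective _≡_ _≡_ z'
      z'-inj {fz} {fz} _ = refl
      z'-inj {fz} {fs j} e = ⊥-elim (d-new j (sym e))
      z'-inj {fs i} {fz} e = ⊥-elim (d-new i e)
      z'-inj {fs i} {fs j} e = cong fs (z-inj p e)
      g'-inj : Injective _≡_ _≡_ g'
      g'-inj {fz} {fz} _ = refl
      g'-inj {fz} {fs j} e = ⊥-elim (f-new j (sym e))
      g'-inj {fs i} {fz} e = ⊥-elim (f-new i e)
      g'-inj {fs i} {fs j} e = cong fs (g-inj p e)
      z'∈g' : ∀ i → ψ (z' (inject₁ i)) ∈ vertexSet (g' i)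
      z'∈g' fz = d∈f
      z'∈g' (fs i) = z∈g p i
      next-z'∈g' : ∀ i → ψ (z' (fs i)) ∈ vertexSet (g' i)
      next-z'∈g' fz = end∈f
      next-z'∈g' (fs i) = next-z∈g p i
      g'≢e₀ : ∀ i → g' i ≢ e₀
      g'≢e₀ fz = f≢e₀
      g'≢e₀ (fs i) = g≢e₀ p i

    Returning : Set
    Returning = ∃ λ l → Σ (Trail l) λ p → ψ (z p fz) ∈ vertexSet e₀ × z p fz ≢ u

    Outside : Fin r → Set
    Outside t = ∃ λ l → Σ (Trail l) λ p → z p fz ≡ t × ψ t ∉ vertexSet e₀

    classify : ∀ {l} (p : Trail l) → z p fz ≢ u → Returning ⊎ Outside (z p fz)
    classify {l} p end≢u with ψ (z p fz) ∈? vertexSet e₀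
    ... | yes end∈e₀ = inj₁ (l , p , end∈e₀ , end≢u)
    ... | no end∉e₀ = inj₂ (l , p , refl , end∉e₀)

    -- Following a walk of F − u, each step either closes the cycle or prolongs the trail,
    -- after cutting off a loop if the new vertex or its hyperedge was already used.
    follow : ∀ {w t} → adj F u w ≡ true → ψ w ∉ vertexSet e₀ → Walk F ⁅ u ⁆ w t → Returning ⊎ Outside t
    follow {w} uw ψw∉e₀ here = inj₂ (1 , first-step , refl , ψw∉e₀)
      where
      w≢u : w ≢ u
      w≢u refl = ψw∉e₀ ψu∈e₀
      f₀ = edge-in-hyperedge uw
      z₀ : Fin 2 → Fin r
      z₀ fz = w
      z₀ (fs _) = u
      z₀-inj : Injective _≡_ _≡_ z₀
      z₀-inj {fz} {fz} _ = refl
      z₀-inj {fz} {fs fz} e = ⊥-elim (w≢u e)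
      z₀-inj {fs fz} {fz} e = ⊥-elim (w≢u (sym e))
      z₀-inj {fs fz} {fs fz} _ = refl
      first-step : Trail 1
      first-step = record
        { z = z₀ ; z-inj = z₀-inj ; g = λ _ → proj₁ f₀ ; g-inj = λ { {fz} {fz} _ → refl }
        ; z∈g = λ { fz → proj₂ (proj₂ f₀) } ; next-z∈g = λ { fz → proj₁ (proj₂ f₀) } ; starts = refl
        ; g≢e₀ = λ { fz f₀≡e₀ → ψw∉e₀ (subst (λ j → ψ w ∈ vertexSet j) f₀≡e₀ (proj₂ (proj₂ f₀))) } }
    follow uw ψw∉e₀ (step {v} {d} walk vd d∉u) with follow uw ψw∉e₀ walk
    ... | inj₁ returning = inj₁ returning
    ... | inj₂ (l , p , refl , ψv∉e₀) = step-to-d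
      where
      d≢u : d ≢ u
      d≢u refl = d∉u (x∈⁅x⁆ u)
      f = proj₁ (edge-in-hyperedge vd)
      ψv∈f = proj₁ (proj₂ (edge-in-hyperedge vd))
      ψd∈f = proj₂ (proj₂ (edge-in-hyperedge vd))
      f≢e₀ : f ≢ e₀
      f≢e₀ f≡e₀ = ψv∉e₀ (subst (λ j → ψ v ∈ vertexSet j) f≡e₀ ψv∈f)
      step-to-d : Returning ⊎ Outside d
      step-to-d with any? (λ i → z p i ≟ d)
      ... | yes d-on-trail with cut-at-vertex p d d-on-trail
      ...   | _ , p' , end≡d =
        subst (λ t → Returning ⊎ Outside t) end≡d (classify p' (λ end≡u → d≢u (trans (sym end≡d) end≡u)))
      step-to-d | no d-new with any? (λ i → g p i ≟ f)
      ... | yes f-used with cut-at-hyperedge p f f-used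
      ...   | _ , p' , end∈f , f-new , on-p =
        classify (extend p' d f end∈f ψd∈f (λ i z≡d → let (j , z≡) = on-p i in d-new (j , trans (sym z≡) z≡d))
                         f-new f≢e₀) d≢u
      step-to-d | no d-new | no f-new =
        classify (extend p d f ψv∈f ψd∈f (λ i z≡d → d-new (i , z≡d)) (λ i g≡f → f-new (i , g≡f)) f≢e₀) d≢u

    last-index : ∀ {K} (i : Fin (2 + K)) → ¬ toℕ i < suc K → i ≡ fromℕ (suc K)
    last-index {K} i i≮1+K = toℕ-injective (trans (toℕ-last i i≮1+K) (sym (toℕ-fromℕ (suc K))))

    -- The hyperedges of the trail, closed up by e₀.
    returning⇒candidate : Returning → CycleCandidate
    returning⇒candidate (zero , p , _ , end≢u) = ⊥-elim (end≢u (starts p))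
    returning⇒candidate (suc K , p , end∈e₀ , _) = record
      { K = K ; h = h ; h-inj = h-inj ; x = z p ; x-inj = z-inj p ; x∈h = x∈h ; next-x∈h = next-x∈h }
      where
      h-by-cases : (i : Fin (2 + K)) → Dec (toℕ i < suc K) → Fin m
      h-by-cases i (yes i<1+K) = g p (fromℕ< i<1+K)
      h-by-cases i (no _) = e₀
      h : Fin (2 + K) → Fin m
      h i = h-by-cases i (toℕ i <? suc K)
      h-inj : Injective _≡_ _≡_ h
      h-inj {i} {j} = by-cases (toℕ i <? suc K) (toℕ j <? suc K)
        where
        by-cases : (di : Dec (toℕ i < suc K)) (dj : Dec (toℕ j < suc K)) → h-by-cases i di ≡ h-by-cases j dj → i ≡ j
        by-cases (yes i<) (yes j<) e =
          toℕ-injective (trans (sym (toℕ-fromℕ< i<)) (trans (cong toℕ (g-inj p e)) (toℕ-fromℕ< j<)))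
        by-cases (yes _) (no _) e = ⊥-elim (g≢e₀ p _ e)
        by-cases (no _) (yes _) e = ⊥-elim (g≢e₀ p _ (sym e))
        by-cases (no i≮) (no j≮) _ = trans (last-index i i≮) (sym (last-index j j≮))
      x∈h : ∀ i → ψ (z p i) ∈ vertexSet (h i)
      x∈h i = by-cases (toℕ i <? suc K)
        where
        by-cases : (d : Dec (toℕ i < suc K)) → ψ (z p i) ∈ vertexSet (h-by-cases i d)
        by-cases (yes i<) = subst (λ j → ψ (z p j) ∈ vertexSet (g p (fromℕ< i<)))
                                  (toℕ-injective (trans (toℕ-inject₁ _) (toℕ-fromℕ< i<))) (z∈g p (fromℕ< i<))
        by-cases (no i≮) = subst (λ j → ψ (z p j) ∈ vertexSet e₀) (sym (last-index i i≮))
                                 (subst (λ v → ψ v ∈ vertexSet e₀) (sym (starts p)) ψu∈e₀)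
      next-x∈h : ∀ i → ψ (z p (next i)) ∈ vertexSet (h i)
      next-x∈h i = by-cases (toℕ i <? suc K)
        where
        by-cases : (d : Dec (toℕ i < suc K)) → ψ (z p (next i)) ∈ vertexSet (h-by-cases i d)
        by-cases (yes i<) = subst (λ j → ψ (z p j) ∈ vertexSet (g p (fromℕ< i<)))
                                  (toℕ-injective (trans (cong suc (toℕ-fromℕ< i<)) (sym (toℕ-next i i<))))
                                  (next-z∈g p (fromℕ< i<))
        by-cases (no i≮) = subst (λ j → ψ (z p j) ∈ vertexSet e₀) (sym (next-last i i≮)) end∈e₀

  module InsideHyperedge (i : Fin m) (F₀⊆i : ∀ a → ψ a ∈ vertexSet i) where

    φ : Fin r → Fin n
    φ = emb (fedge H i)

    -- Only φσ≡ψ is ever used about σ, so its definition is kept out of normalisation.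
    opaque
      σ : Fin r → Fin r
      σ a = proj₁ (∈-image⁻ φ (F₀⊆i a))

      φσ≡ψ : ∀ a → φ (σ a) ≡ ψ a
      φσ≡ψ a = proj₂ (∈-image⁻ φ (F₀⊆i a))

    σ-inj : Injective _≡_ _≡_ σ
    σ-inj {a} {b} e = ψ-inj (trans (sym (φσ≡ψ a)) (trans (cong φ e) (φσ≡ψ b)))

    σ⁻¹ : Fin r → Fin r
    σ⁻¹ y = proj₁ (injective⇒surjective σ σ-inj y)

    σσ⁻¹ : ∀ y → σ (σ⁻¹ y) ≡ y
    σσ⁻¹ y = proj₂ (injective⇒surjective σ σ-inj y)

    φ≡ψσ⁻¹ : ∀ y → φ y ≡ ψ (σ⁻¹ y)
    φ≡ψσ⁻¹ y = trans (cong φ (sym (σσ⁻¹ y))) (φσ≡ψ (σ⁻¹ y))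

    EdgeOfCopy⇒adj-σ : ∀ a b → EdgeOfCopy (fedge H i) (ψ a) (ψ b) → adj F (σ a) (σ b) ≡ true
    EdgeOfCopy⇒adj-σ a b (c , d , φc≡ψa , φd≡ψb , cd)
      with embInj (fedge H i) (trans φc≡ψa (sym (φσ≡ψ a))) | embInj (fedge H i) (trans φd≡ψb (sym (φσ≡ψ b)))
    ... | refl | refl = cd

    -- σ preserves edges and F has as many edges as its relabelling, so σ also reflects them.
    edge-preserving⇒SameCopy : (∀ a b → adj F a b ≡ true → adj F (σ a) (σ b) ≡ true) → SameCopy F₀ (fedge H i)
    edge-preserving⇒SameCopy σ-preserves =
      (λ v → mk⇔ (λ (a , ψa≡v) → σ a , trans (φσ≡ψ a) ψa≡v)
                 (λ (y , φy≡v) → σ⁻¹ y , trans (sym (φ≡ψσ⁻¹ y)) φy≡v)) ,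
      (λ u v → mk⇔ (λ { (a , b , refl , refl , ab) → σ a , σ b , φσ≡ψ a , φσ≡ψ b , σ-preserves a b ab })
                   (λ (c , d , φc≡u , φd≡v , cd) →
                      σ⁻¹ c , σ⁻¹ d , trans (sym (φ≡ψσ⁻¹ c)) φc≡u , trans (sym (φ≡ψσ⁻¹ d)) φd≡v ,
                      σ-reflects (σ⁻¹ c) (σ⁻¹ d) (subst₂ (λ c' d' → adj F c' d' ≡ true) (sym (σσ⁻¹ c)) (sym (σσ⁻¹ d)) cd)))
      where
      σ-reflects : ∀ a b → adj F (σ a) (σ b) ≡ true → adj F a b ≡ true
      σ-reflects = pairCount-≤⇒⊇ (adj F) (λ a b → adj F (σ a) (σ b)) σ-preserves
                     (≤-reflexive (pairCount-permute σ σ-inj (adj F)))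

    missing-edge : ¬ SameCopy F₀ (fedge H i) → ∃ λ a → ∃ λ b → adj F a b ≡ true × adj F (σ a) (σ b) ≡ false
    missing-edge F₀≢i with any? (λ a → any? (λ b → (adj F a b ≟ᵇ true) ×-dec (adj F (σ a) (σ b) ≟ᵇ false)))
    ... | yes found = found
    ... | no none =
      ⊥-elim (F₀≢i (edge-preserving⇒SameCopy λ a b ab → ¬false⇒true λ σab≡false → none (a , b , ab , σab≡false)))
      where
      ¬false⇒true : ∀ {x} → x ≢ false → x ≡ true
      ¬false⇒true {true} _ = refl
      ¬false⇒true {false} x≢false = ⊥-elim (x≢false refl)

    other-hyperedge : ∀ {a b} → adj F a b ≡ true → adj F (σ a) (σ b) ≡ false →
                      ∃ λ l → l ≢ i × ψ a ∈ vertexSet l × ψ b ∈ vertexSet l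
    other-hyperedge {a} {b} ab σab≡false with edge-of-F₀ ab
    ... | l , ab∈l = l , l≢i , EdgeOfCopy⇒∈ ab∈l
      where
      l≢i : l ≢ i
      l≢i refl with trans (sym σab≡false) (EdgeOfCopy⇒adj-σ a b ab∈l)
      ... | ()

    two-cycle : ∀ {a b} → adj F a b ≡ true → adj F (σ a) (σ b) ≡ false → CycleCandidate
    two-cycle {a} {b} ab σab≡false with other-hyperedge ab σab≡false
    ... | l , l≢i , ψa∈l , ψb∈l =
      record { K = 0 ; h = h ; h-inj = h-inj ; x = x ; x-inj = x-inj ; x∈h = x∈h ; next-x∈h = next-x∈h }
      where
      h : Fin 2 → Fin m
      h fz = i
      h (fs _) = l
      x : Fin 2 → Fin r
      x fz = a
      x (fs _) = b
      h-inj : Injective _≡_ _≡_ h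
      h-inj {fz} {fz} _ = refl
      h-inj {fz} {fs fz} e = ⊥-elim (l≢i (sym e))
      h-inj {fs fz} {fz} e = ⊥-elim (l≢i e)
      h-inj {fs fz} {fs fz} _ = refl
      x-inj : Injective _≡_ _≡_ x
      x-inj {fz} {fz} _ = refl
      x-inj {fz} {fs fz} e = ⊥-elim (adjacent⇒≢ {F = F} ab e)
      x-inj {fs fz} {fz} e = ⊥-elim (adjacent⇒≢ {F = F} ab (sym e))
      x-inj {fs fz} {fs fz} _ = refl
      x∈h : ∀ j → ψ (x j) ∈ vertexSet (h j)
      x∈h fz = F₀⊆i a
      x∈h (fs fz) = ψb∈l
      next-x∈h : ∀ j → ψ (x (next j)) ∈ vertexSet (h j)
      next-x∈h fz = F₀⊆i b
      next-x∈h (fs fz) = ψa∈l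

    ψ∈i : ∀ a → ψ a ∈ subVerts H ⁅ i ⁆
    ψ∈i a = ∈subVerts⁺ (x∈⁅x⁆ i) (∈⇒InHE (F₀⊆i a))

    ψ∈i∪ : ∀ {l} a → ψ a ∈ subVerts H (⁅ i ⁆ ∪ ⁅ l ⁆)
    ψ∈i∪ a = ∈subVerts⁺ (x∈p∪q⁺ (inj₁ (x∈⁅x⁆ i))) (∈⇒InHE (F₀⊆i a))

    two-missing-edges⇒avoidable : ∀ {a b a' b'} → adj F a b ≡ true → adj F (σ a) (σ b) ≡ false →
                                  adj F a' b' ≡ true → adj F (σ a') (σ b') ≡ false → ¬ SamePair a' b' a b →
                                  HasAvoidable H
    two-missing-edges⇒avoidable {a} {b} {a'} {b'} ab σab a'b' σa'b' ¬same
      with other-hyperedge ab σab | other-hyperedge a'b' σa'b'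
    ... | l , l≢i , ψa∈l , ψb∈l | l' , l'≢i , ψa'∈l' , ψb'∈l' = by-cases (l' ≟ l)
      where
      l∉i : l ∉ ⁅ i ⁆
      l∉i l∈ = l≢i (x∈⁅y⁆⇒x≡y _ l∈)
      rooted-il : Rooted (⁅ i ⁆ ∪ ⁅ l ⁆) (ψ a)
      rooted-il = rooted-∪⁅⁆ (rooted-⁅⁆ (∈⇒InHE (F₀⊆i a))) (ψ∈i a) (∈⇒InHE ψa∈l)
      ∣il∣≡2 : ∣ ⁅ i ⁆ ∪ ⁅ l ⁆ ∣ ≡ 2
      ∣il∣≡2 = trans (∣p∪⁅x⁆∣≡1+∣p∣ ⁅ i ⁆ l l∉i) (cong suc (∣⁅x⁆∣≡1 i))
      ψa≢ψb : ψ a ≢ ψ b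
      ψa≢ψb e = adjacent⇒≢ {F = F} ab (ψ-inj e)
      third : ∃ λ c → (c ≡ a' ⊎ c ≡ b') × c ≢ a × c ≢ b
      third with a' ≟ a | a' ≟ b | b' ≟ a | b' ≟ b
      ... | no a'≢a | no a'≢b | _ | _ = a' , inj₁ refl , a'≢a , a'≢b
      ... | _ | _ | no b'≢a | no b'≢b = b' , inj₂ refl , b'≢a , b'≢b
      ... | yes refl | _ | yes refl | _ = ⊥-elim (adjacent⇒≢ {F = F} a'b' refl)
      ... | yes refl | _ | no _ | yes refl = ⊥-elim (¬same (inj₁ (refl , refl)))
      ... | no _ | yes refl | yes refl | _ = ⊥-elim (¬same (inj₂ (refl , refl)))
      ... | no _ | yes refl | no _ | yes refl = ⊥-elim (adjacent⇒≢ {F = F} a'b' refl)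
      by-cases : Dec (l' ≡ l) → HasAvoidable H
      by-cases (yes refl) = avoidable 2<r rooted-il
        (nullity-∪⁅⁆ l 2 l∉i (nullity-⁅⁆ i)
          (three-elements⇒3≤∣p∣ (x∈p∩q⁺ (ψa∈l , ψ∈i a)) (x∈p∩q⁺ (ψb∈l , ψ∈i b)) (x∈p∩q⁺ (ψc∈l , ψ∈i c))
                                ψa≢ψb (λ e → c≢a (ψ-inj (sym e))) (λ e → c≢b (ψ-inj (sym e)))))
        (≤-trans (≤-reflexive ∣il∣≡2) (≤-trans (s≤s (s≤s z≤n)) (≤-trans 2<r (n≤1+n r))))
        where
        c = proj₁ third
        c≢a = proj₁ (proj₂ (proj₂ third))
        c≢b = proj₂ (proj₂ (proj₂ third))
        ψc∈l : ψ c ∈ vertexSet l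
        ψc∈l = [ (λ c≡a' → subst (λ y → ψ y ∈ vertexSet l) (sym c≡a') ψa'∈l')
               , (λ c≡b' → subst (λ y → ψ y ∈ vertexSet l) (sym c≡b') ψb'∈l') ]′ (proj₁ (proj₂ third))
      by-cases (no l'≢l) = avoidable 2<r
        (rooted-∪⁅⁆ rooted-il (ψ∈i∪ a') (∈⇒InHE ψa'∈l'))
        (nullity-∪⁅⁆ l' 1 l'∉il
          (nullity-∪⁅⁆ l 1 l∉i (nullity-⁅⁆ i) (two-elements⇒2≤∣p∣ (x∈p∩q⁺ (ψa∈l , ψ∈i a)) (x∈p∩q⁺ (ψb∈l , ψ∈i b)) ψa≢ψb))
          (two-elements⇒2≤∣p∣ (x∈p∩q⁺ (ψa'∈l' , ψ∈i∪ a')) (x∈p∩q⁺ (ψb'∈l' , ψ∈i∪ b'))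
                              (λ e → adjacent⇒≢ {F = F} a'b' (ψ-inj e))))
        (≤-trans (≤-reflexive (trans (∣p∪⁅x⁆∣≡1+∣p∣ _ l' l'∉il) (cong suc ∣il∣≡2))) (≤-trans 2<r (n≤1+n r)))
        where
        l'∉il : l' ∉ ⁅ i ⁆ ∪ ⁅ l ⁆
        l'∉il l'∈ = [ (λ l'∈i → l'≢i (x∈⁅y⁆⇒x≡y _ l'∈i)) , (λ l'∈l → l'≢l (x∈⁅y⁆⇒x≡y _ l'∈l)) ]′ (x∈p∪q⁻ _ _ l'∈)

    Q : Rel₂ r
    Q u v = adj F (σ u) (σ v)

    Missing : Rel₂ r
    Missing u v = adj F u v ∧ not (Q u v)

    Surplus : Rel₂ r
    Surplus u v = Q u v ∧ not (adj F u v)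

    ∧-not≡true⁻ : ∀ {x y} → x ∧ not y ≡ true → x ≡ true × y ≡ false
    ∧-not≡true⁻ {true} {false} _ = refl , refl

    ∧-not≡true⁺ : ∀ {x y} → x ≡ true → y ≡ false → x ∧ not y ≡ true
    ∧-not≡true⁺ refl refl = refl

    pairCount-Surplus≡pairCount-Missing : pairCount Surplus ≡ pairCount Missing
    pairCount-Surplus≡pairCount-Missing = +-cancelˡ-≡ (pairCount (λ u v → Q u v ∧ adj F u v)) _ _ (begin
      pairCount (λ u v → Q u v ∧ adj F u v) + pairCount Surplus   ≡⟨ pairCount-split Q (adj F) ⟨
      pairCount Q                                                  ≡⟨ pairCount-permute σ σ-inj (adj F) ⟩
      pairCount (adj F)                                            ≡⟨ pairCount-split (adj F) Q ⟩
      pairCount (λ u v → adj F u v ∧ Q u v) + pairCount Missing    ≡⟨ cong (_+ pairCount Missing) both-commute ⟩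
      pairCount (λ u v → Q u v ∧ adj F u v) + pairCount Missing    ∎)
      where
      open ≡-Reasoning
      both-commute : pairCount (λ u v → adj F u v ∧ Q u v) ≡ pairCount (λ u v → Q u v ∧ adj F u v)
      both-commute = sumFin-cong λ u → sumFin-cong λ v → cong indicator (∧-comm (adj F u v) (Q u v))

    -- Copy i has as many edges as F₀, so besides the missing edge ab it has exactly one surplus edge cd.
    unique-missing-edge⇒swap : ∀ {a b} → adj F a b ≡ true → Q a b ≡ false →
                               (∀ a' b' → adj F a' b' ≡ true → Q a' b' ≡ false → SamePair a' b' a b) →
                               ∃ λ c → ∃ λ d → Q c d ≡ true × SwapIso F (σ a) (σ b) (σ c) (σ d)
    unique-missing-edge⇒swap {a} {b} ab σab only-ab = c , d , Qcd , σ , σ-inj , swap-preserved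
      where
      Missing-only-ab : ∀ u v → Missing u v ≡ true → SamePair u v a b
      Missing-only-ab u v Muv = only-ab u v (proj₁ (∧-not≡true⁻ {adj F u v} Muv)) (proj₂ (∧-not≡true⁻ {adj F u v} Muv))
      Surplus≤2 : pairCount Surplus ≤ 2
      Surplus≤2 = ≤-trans (≤-reflexive pairCount-Surplus≡pairCount-Missing)
                          (pairCount-one-pair≤2 Missing (adjacent⇒≢ {F = F} ab) Missing-only-ab)
      0<Surplus : 0 < pairCount Surplus
      0<Surplus = ≤-trans (≤-trans (entry≤row Missing (∧-not≡true⁺ ab σab)) (term≤sumFin (row Missing) a))
                          (≤-reflexive (sym pairCount-Surplus≡pairCount-Missing))
      surplus = 0<pairCount⇒∃ Surplus 0<Surplus
      c = proj₁ surplus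
      d = proj₁ (proj₂ surplus)
      Qcd : Q c d ≡ true
      Qcd = proj₁ (∧-not≡true⁻ {Q c d} (proj₂ (proj₂ surplus)))
      Pcd : adj F c d ≡ false
      Pcd = proj₂ (∧-not≡true⁻ {Q c d} (proj₂ (proj₂ surplus)))
      Surplus-sym : ∀ u v → Surplus u v ≡ Surplus v u
      Surplus-sym u v = cong₂ (λ x y → x ∧ not y) (adj-sym F (σ u) (σ v)) (adj-sym F u v)
      Surplus-only-cd : ∀ u v → Surplus u v ≡ true → SamePair u v c d
      Surplus-only-cd = symmetric-pairCount≤2⇒one-pair Surplus Surplus-sym Surplus≤2
                          (λ c≡d → adjacent⇒≢ {F = F} Qcd (cong σ c≡d)) (proj₂ (proj₂ surplus))
      Surplus-only-cd′ : ∀ u v → Q u v ≡ true → adj F u v ≡ false → SamePair u v c d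
      Surplus-only-cd′ u v Quv Puv = Surplus-only-cd u v (∧-not≡true⁺ Quv Puv)
      swap-preserved : ∀ u v → swapAdj F (σ a) (σ b) (σ c) (σ d) (σ u) (σ v) ≡ adj F u v
      swap-preserved = relabelling-swap F σ σ-inj ab Pcd only-ab Surplus-only-cd′

    avoidable-unless-swap : NoSwap F → ¬ SameCopy F₀ (fedge H i) → HasAvoidable H
    avoidable-unless-swap no-swap F₀≢i =
      by-cases (any? (λ a' → any? (λ b' → (adj F a' b' ≟ᵇ true) ×-dec
                                           ((Q a' b' ≟ᵇ false) ×-dec ¬? (samePair? a' b' a b)))))
      where
      a = proj₁ (missing-edge F₀≢i)
      b = proj₁ (proj₂ (missing-edge F₀≢i))
      ab = proj₁ (proj₂ (proj₂ (missing-edge F₀≢i)))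
      σab = proj₂ (proj₂ (proj₂ (missing-edge F₀≢i)))
      by-cases : Dec (∃ λ a' → ∃ λ b' → adj F a' b' ≡ true × Q a' b' ≡ false × ¬ SamePair a' b' a b) → HasAvoidable H
      by-cases (yes (a' , b' , a'b' , σa'b' , ¬same)) = two-missing-edges⇒avoidable ab σab a'b' σa'b' ¬same
      by-cases (no none) = ⊥-elim (no-swap (σ a) (σ b) (σ c) (σ d) (λ e → adjacent⇒≢ {F = F} ab (σ-inj e)) σab Qcd swap)
        where
        only-ab : ∀ a' b' → adj F a' b' ≡ true → Q a' b' ≡ false → SamePair a' b' a b
        only-ab a' b' a'b' σa'b' = decidable-stable (samePair? a' b' a b) λ ¬same → none (a' , b' , a'b' , σa'b' , ¬same)
        swapped = unique-missing-edge⇒swap ab σab only-ab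
        c = proj₁ swapped
        d = proj₁ (proj₂ swapped)
        Qcd = proj₁ (proj₂ (proj₂ swapped))
        swap = proj₂ (proj₂ (proj₂ swapped))

  a₀ : Fin r
  a₀ = proj₁ (other-vertex k2 ∅ (≤-trans (≤-reflexive (∣⊥∣≡0 r)) z≤n))

  b₀ : Fin r
  b₀ = proj₁ (neighbour k2 a₀)

  b₀a₀ : adj F b₀ a₀ ≡ true
  b₀a₀ = proj₂ (neighbour k2 a₀)

  e₀ : Fin m
  e₀ = proj₁ (edge-in-hyperedge b₀a₀)

  ψb₀∈e₀ : ψ b₀ ∈ vertexSet e₀
  ψb₀∈e₀ = proj₁ (proj₂ (edge-in-hyperedge b₀a₀))

  ψa₀∈e₀ : ψ a₀ ∈ vertexSet e₀
  ψa₀∈e₀ = proj₂ (proj₂ (edge-in-hyperedge b₀a₀))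

  another-in-e₀ : ∀ u → ∃ λ p → p ≢ u × ψ p ∈ vertexSet e₀
  another-in-e₀ u = by-cases (a₀ ≟ u)
    where
    by-cases : Dec (a₀ ≡ u) → ∃ λ p → p ≢ u × ψ p ∈ vertexSet e₀
    by-cases (yes a₀≡u) = b₀ , (λ b₀≡u → adjacent⇒≢ {F = F} b₀a₀ (trans b₀≡u (sym a₀≡u))) , ψb₀∈e₀
    by-cases (no a₀≢u) = a₀ , a₀≢u , ψa₀∈e₀

  returning-trail : ∀ {u w} → adj F u w ≡ true → (ψu∈e₀ : ψ u ∈ vertexSet e₀) → ψ w ∉ vertexSet e₀ →
                    Trails.Returning e₀ u ψu∈e₀
  returning-trail {u} {w} uw ψu∈e₀ ψw∉e₀ =
    [ id , (λ (_ , _ , _ , ψp∉e₀) → ⊥-elim (ψp∉e₀ ψp∈e₀)) ]′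
      (Trails.follow e₀ u ψu∈e₀ uw ψw∉e₀ (connected-minus k2 u w p w≢u p≢u))
    where
    p = proj₁ (another-in-e₀ u)
    p≢u = proj₁ (proj₂ (another-in-e₀ u))
    ψp∈e₀ = proj₂ (proj₂ (another-in-e₀ u))
    w≢u : w ≢ u
    w≢u refl = ψw∉e₀ ψu∈e₀

  cycle-candidate : (∀ i → ¬ SameCopy F₀ (fedge H i)) → CycleCandidate
  cycle-candidate F₀≢ = by-cases (any? (λ a → ¬? (ψ a ∈? vertexSet e₀)))
    where
    by-cases : Dec (∃ λ a → ψ a ∉ vertexSet e₀) → CycleCandidate
    by-cases (no F₀⊆e₀) =
      InsideHyperedge.two-cycle e₀ F₀⊆e₀' (proj₁ (proj₂ (proj₂ missing))) (proj₂ (proj₂ (proj₂ missing)))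
      where
      F₀⊆e₀' : ∀ a → ψ a ∈ vertexSet e₀
      F₀⊆e₀' a = decidable-stable (ψ a ∈? vertexSet e₀) λ ψa∉ → F₀⊆e₀ (a , ψa∉)
      missing = InsideHyperedge.missing-edge e₀ F₀⊆e₀' (F₀≢ e₀)
    by-cases (yes (outside , ψoutside∉e₀)) =
      Trails.returning⇒candidate e₀ u ψu∈e₀ (returning-trail uw ψu∈e₀ ψw∉e₀)
      where
      leaving = walk-leaves (λ v → ψ v ∈ vertexSet e₀) (λ v → ψ v ∈? vertexSet e₀)
                            (connected k2 a₀ outside) ψa₀∈e₀ ψoutside∉e₀
      u = proj₁ leaving
      w = proj₁ (proj₂ leaving)
      uw = proj₁ (proj₂ (proj₂ leaving))
      ψu∈e₀ = proj₁ (proj₂ (proj₂ (proj₂ leaving)))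
      ψw∉e₀ = proj₂ (proj₂ (proj₂ (proj₂ leaving)))

  module CleanCycle (c : CycleCandidate) (clean : Candidate.Clean c) (k3 : KConnected 3 F) where
    open Candidate c

    only-consecutive : ∀ i j → ψ (x i) ∈ vertexSet (h j) → i ≡ j ⊎ i ≡ next j
    only-consecutive = proj₁ clean

    only-cycle-vertices-shared : ∀ j l v → j ≢ l → v ∈ vertexSet (h j) → v ∈ vertexSet (h l) → ∃ λ i → ψ (x i) ≡ v
    only-cycle-vertices-shared = proj₁ (proj₂ clean)

    opaque
     edge-in-cycle : ∀ {v t} → adj F v t ≡ true → ∃ λ l → ψ v ∈ vertexSet (h l) × ψ t ∈ vertexSet (h l)
     edge-in-cycle {v} {t} vt with proj₂ (proj₂ clean) v t vt
     ... | _ , j∈𝒞 , ψv∈j , ψt∈j with ∈-image⁻ h j∈𝒞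
     ... | l , refl = l , ψv∈j , ψt∈j

    -- Walking in F − {x j, x (j+1)} from a vertex p of h j off the cycle never leaves h j,
    -- since h j meets the other hyperedges only in cycle vertices.
    off-cycle⇒F₀⊆h : ∀ p → (∀ i → x i ≢ p) → ∃ λ j → ∀ o → ψ o ∈ vertexSet (h j)
    off-cycle⇒F₀⊆h p p-off = j , λ o → decidable-stable (ψ o ∈? vertexSet (h j)) λ ψo∉j →
      ψo∉j (proj₁ (stays (connected-minus-two k3 (x j) (x (next j)) p o (p∉Z p-off) (o∉Z ψo∉j))))
      where
      j = proj₁ (edge-in-cycle (proj₂ (neighbour k2 p)))
      ψp∈j = proj₂ (proj₂ (edge-in-cycle (proj₂ (neighbour k2 p))))
      Z = ⁅ x j ⁆ ∪ ⁅ x (next j) ⁆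
      p∉Z : ∀ {p} → (∀ i → x i ≢ p) → p ∉ Z
      p∉Z p-off p∈ = [ (λ p∈j → p-off j (sym (x∈⁅y⁆⇒x≡y _ p∈j)))
                     , (λ p∈next → p-off (next j) (sym (x∈⁅y⁆⇒x≡y _ p∈next))) ]′ (x∈p∪q⁻ _ _ p∈)
      o∉Z : ∀ {o} → ψ o ∉ vertexSet (h j) → o ∉ Z
      o∉Z ψo∉j o∈ = [ (λ o∈j → ψo∉j (subst (λ y → ψ y ∈ vertexSet (h j)) (sym (x∈⁅y⁆⇒x≡y _ o∈j)) (x∈h j)))
                    , (λ o∈next → ψo∉j (subst (λ y → ψ y ∈ vertexSet (h j)) (sym (x∈⁅y⁆⇒x≡y _ o∈next)) (next-x∈h j))) ]′
                    (x∈p∪q⁻ _ _ o∈)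
      stays : ∀ {t} → Walk F Z p t → ψ t ∈ vertexSet (h j) × (∀ i → x i ≢ t)
      stays here = ψp∈j , p-off
      stays (step {v} {t} walk vt t∉Z) =
        step-stays (proj₁ (stays walk)) (proj₂ (stays walk)) (edge-in-cycle vt) t∉Z
        where
        step-stays : ψ v ∈ vertexSet (h j) → (∀ i → x i ≢ v) →
                     ∃ (λ l → ψ v ∈ vertexSet (h l) × ψ t ∈ vertexSet (h l)) → t ∉ Z →
                     ψ t ∈ vertexSet (h j) × (∀ i → x i ≢ t)
        step-stays ψv∈j v-off (l , ψv∈l , ψt∈l) t∉Z = by-cases (l ≟ j)
          where
          by-cases : Dec (l ≡ j) → ψ t ∈ vertexSet (h j) × (∀ i → x i ≢ t)
          by-cases (no l≢j) = ⊥-elim (v-off (proj₁ shared) (ψ-inj (proj₂ shared)))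
            where shared = only-cycle-vertices-shared j l (ψ v) (λ j≡l → l≢j (sym j≡l)) ψv∈j ψv∈l
          by-cases (yes refl) = ψt∈l , t-off
            where
            t-off : ∀ i → x i ≢ t
            t-off i refl = [ (λ { refl → t∉Z (x∈p∪q⁺ (inj₁ (x∈⁅x⁆ (x i)))) })
                           , (λ { refl → t∉Z (x∈p∪q⁺ (inj₂ (x∈⁅x⁆ (x i)))) }) ]′ (only-consecutive i l ψt∈l)

    -- If F₀ had only cycle vertices, x 0 would be adjacent to x 1 and x (k − 1) only.
    on-cycle⇒⊥ : (∀ a → ∃ λ i → x i ≡ a) → ⊥
    on-cycle⇒⊥ on-cycle = w∉ (x∈p∪q⁺ (inj₂ (subst (_∈ ⁅ x fz ⁆) (sym (isolated walk)) (x∈⁅x⁆ (x fz)))))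
      where
      last = proj₁ (previous {suc K} fz)
      next-last≡0 = proj₂ (previous {suc K} fz)
      Z = ⁅ x (next fz) ⁆ ∪ ⁅ x last ⁆
      x0∉Z : x fz ∉ Z
      x0∉Z x0∈ = [ (λ e → next-≢ fz (sym (x-inj (x∈⁅y⁆⇒x≡y _ e))))
                 , (λ e → next-≢ last (trans next-last≡0 (x-inj (x∈⁅y⁆⇒x≡y _ e)))) ]′
                   (x∈p∪q⁻ _ _ x0∈)
      other = other-vertex k3 (Z ∪ ⁅ x fz ⁆)
                (≤-trans (∣p∪q∣≤∣p∣+∣q∣ Z ⁅ x fz ⁆)
                         (+-mono-≤ (∣⁅x⁆∪⁅y⁆∣≤2 (x (next fz)) (x last)) (≤-reflexive (∣⁅x⁆∣≡1 (x fz)))))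
      w = proj₁ other
      w∉ = proj₂ other
      walk : Walk F Z (x fz) w
      walk = connected-minus-two k3 (x (next fz)) (x last) (x fz) w x0∉Z (λ w∈ → w∉ (x∈p∪q⁺ (inj₁ w∈)))
      isolated : ∀ {t} → Walk F Z (x fz) t → t ≡ x fz
      isolated here = refl
      isolated (step {v} {t} walk vt t∉Z) =
        neighbour-of-x0 (isolated walk) (on-cycle t) (edge-in-cycle vt) t∉Z (adjacent⇒≢ {F = F} vt)
        where
        neighbour-of-x0 : v ≡ x fz → ∃ (λ i → x i ≡ t) → ∃ (λ l → ψ v ∈ vertexSet (h l) × ψ t ∈ vertexSet (h l)) →
                          t ∉ Z → v ≢ t → t ≡ x fz
        neighbour-of-x0 refl (i , refl) (l , ψx0∈l , ψxi∈l) t∉Z v≢t =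
          by-cases (only-consecutive fz l ψx0∈l) (only-consecutive i l ψxi∈l)
          where
          by-cases : fz ≡ l ⊎ fz ≡ next l → i ≡ l ⊎ i ≡ next l → x i ≡ x fz
          by-cases (inj₁ refl) (inj₁ refl) = refl
          by-cases (inj₁ refl) (inj₂ refl) = ⊥-elim (t∉Z (x∈p∪q⁺ (inj₁ (x∈⁅x⁆ _))))
          by-cases (inj₂ 0≡next-l) (inj₁ refl) =
            ⊥-elim (t∉Z (x∈p∪q⁺ (inj₂ (subst (λ y → x i ∈ ⁅ x y ⁆) (next-injective (trans (sym 0≡next-l) (sym next-last≡0)))
                                                        (x∈⁅x⁆ (x i))))))
          by-cases (inj₂ 0≡next-l) (inj₂ i≡next-l) = ⊥-elim (v≢t (cong x (trans 0≡next-l (sym i≡next-l))))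

    F₀⊆some-h : ∃ λ j → ∀ a → ψ a ∈ vertexSet (h j)
    F₀⊆some-h = by-cases (any? (λ a → ¬? (any? (λ i → x i ≟ a))))
      where
      by-cases : Dec (∃ λ a → ¬ ∃ λ i → x i ≡ a) → ∃ λ j → ∀ a → ψ a ∈ vertexSet (h j)
      by-cases (yes (p , p-off)) = off-cycle⇒F₀⊆h p λ i x≡p → p-off (i , x≡p)
      by-cases (no none) = ⊥-elim (on-cycle⇒⊥ λ a → decidable-stable (any? (λ i → x i ≟ a)) λ a-off → none (a , a-off))

  avoidable-or-clean-cycle : CycleCandidate →
                             HasAvoidable H ⊎ (Σ ℕ λ k → 2 ≤ k × k ≤ numEdges F × CleanCycleCovering H k F₀)
  avoidable-or-clean-cycle c = Sum.map₂
    (λ clean → k , s≤s (s≤s z≤n) , ≤-trans (injective⇒≤ x-inj) (vertices≤edges {F = F} k2) , clean⇒CleanCycleCovering clean)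
    avoidable-or-clean
    where open Candidate c

  nice⇒avoidable : (∀ i → ¬ SameCopy F₀ (fedge H i)) → Nice F → CycleCandidate → HasAvoidable H
  nice⇒avoidable F₀≢ (_ , k3 , no-swap) c = [ id , F₀-inside-cycle ]′ avoidable-or-clean
    where
    open Candidate c
    F₀-inside-cycle : Clean → HasAvoidable H
    F₀-inside-cycle clean = InsideHyperedge.avoidable-unless-swap (h j) F₀⊆hj no-swap (F₀≢ (h j))
      where
      j = proj₁ (CleanCycle.F₀⊆some-h c clean k3)
      F₀⊆hj = proj₂ (CleanCycle.F₀⊆some-h c clean k3)

lemma3 : ∀ {r} (F : Graph r) → KConnected 2 F →
         ∀ {n m} (H : FGraph F n m) (F₀ : Copy F n) →
         (∀ i → ¬ SameCopy F₀ (fedge H i)) →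
         CopyInG H F₀ →
         (HasAvoidable H ⊎
           (Σ ℕ λ k → 2 ≤ k × k ≤ numEdges F × CleanCycleCovering H k F₀))
         × (Nice F → HasAvoidable H)
lemma3 F k2 H F₀ F₀≢ F₀⊆G =
  avoidable-or-clean-cycle (cycle-candidate F₀≢) , λ nice → nice⇒avoidable F₀≢ nice (cycle-candidate F₀≢)
  where open Covering k2 H F₀ F₀⊆G
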